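{- Set $u=1$. For all $t,j,k,\ell\in\mathbb N$, $$(D^{(t)}A)_{0,j,k,\ell}-q(AD^{(t+1)})_{0,j,k,\ell}=(AE^{(t+1)})_{0,j,k,\ell}-q(E^{(t)}A)_{0,j,k,\ell}=\alpha\beta A_{0,j,k,\ell}-\gamma\delta q^{2t+k+2}A_{0,j-1,k,\ell}+(1-q)(F^{(t)}A)_{0,j,k,\ell}.$$
   Context: Matrices (product $(MM')_{i,j,k,\ell}=\sum_{a,b}M_{i,a,k,b}M'_{a,j,b,\ell}$; negative-index entries $0$; $[t]_q=1+\dots+q^{t-1}$): $D^{(t)}_{i,j,k,\ell}=0$ if $j<i$ or $\ell>k+1$; $=\alpha q^i$ if $k=0,\ell=1,i=j$; $=\delta q^i(q^t+(\alpha+\gamma q^t)[t]_q)$ if $k=\ell=0,j=i+1$; otherwise $=\delta(D^{(t)}+E^{(t)})_{i,j-1,k-1,\ell}+D^{(t)}_{i,j,k-1,\ell-1}$. $E^{(t)}_{i,j,k,\ell}=0$ if $j<i$ or $\ell>k+1$; $=\gamma q^{2t+i}$ if $k=0,\ell=1,i=j$; $=\beta q^i(q^t+(\alpha+\gamma q^t)[t]_q)$ if $k=\ell=0,i=j$; otherwise $=\beta(D^{(t)}+E^{(t)})_{i,j,k-1,\ell}+qE^{(t)}_{i,j,k-1,\ell-1}$. $A_{i,j,k,\ell}=0$ if $\ell>k$ or $j-i>k-\ell$; $=q^{2i}$ if $i=j,k=\ell=0$; otherwise $=\beta A_{i,j,k-1,\ell}+\delta qA_{i,j-1,k-1,\ell}+qA_{i,j,k-1,\ell-1}$.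 $F^{(t)}_{i,j,k,\ell}$ is the weight generating function for all ways of adding a new vertical strip of type $F^{(t)}$ (a 02-column with exactly $t$ short rhombi and at least two squares, $\delta$ in its bottom square, and $\beta$ as the next Greek letter above that $\delta$, in a square) to the left of a rhombic staircase tableau with $i$ horizontal $\delta$-strips and $k$ horizontal $\alpha/\gamma$-strips, so as to obtain one with $j$ horizontal $\delta$-strips and $\ell$ horizontal $\alpha/\gamma$-strips. Tableaux: for $\tau\in\{0,1,2\}^N$ ($j$ a 1-position if $\tau_j=1$, else a 02-position), the maximal tiling of $\Gamma(\tau)$ has columns $C_1..C_N$ right to left; a 02-column $C_j$ has squares $s(p,j)$ for 02-positions $p\le j$ ($s(j,j)$ at the bottom, $s(p,j)$ above $s(p',j)$ if $p<p'$) topped by one short rhombus per 1-position $i<j$; a 1-column $C_j$ has tall rhombi $\rho(p,j)$, one per 02-position $p<j$. Vertical strips: the 02-columns (bottom to top). Horizontal strip $H_p$: $s(p,p)$ and $s(p,j)$ or $\rho(p,j)$ for $j>p$, right to left. Rhombic staircase tableau: squares empty or $\alpha,\beta,\gamma,\delta$; tall rhombi empty or $\beta u,\delta q$; short rhombi empty or $\alpha u,\gamma q$; lowest square of each vertical strip nonempty; tiles above an $\alpha/\gamma$ (incl. $\alpha u,\gamma q$) in a vertical strip empty; tiles left of a $\beta/\delta$ (incl. $\beta u,\delta q$) in a horizontal strip empty. A horizontal strip is a $\delta$-strip (resp. $\alpha/\gamma$-strip) if its leftmost tile containing a Greek letter contains $\delta$ (resp. $\alpha$ or $\gamma$). Weight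 of an empty tile ("sees" = closest nonempty tile to the right in its horizontal strip / below in its vertical strip; $\alpha u$ etc. count as $\alpha$ etc.): square seeing $\beta$/$\delta$ right: $u$/$q$; seeing $\alpha/\gamma$ right and $\alpha/\delta$ below: $u$; seeing $\alpha/\gamma$ right and $\beta/\gamma$ below: $q$; tall rhombus seeing $\beta$, $\delta$, $\alpha/\gamma$ right: $u^2,q^2,uq$; short rhombus seeing $\alpha$, $\gamma$, $\beta/\delta$ below: $u^2,q^2,uq$; an added column's weight is the product of labels and monomials of its tiles. -}

module Defs where

open import Algebra.Bundles using (CommutativeRing)
open import Data.Nat using (ℕ; zero; suc; _<ᵇ_; _≡ᵇ_)
import Data.Nat as N
open import Data.Bool using (Bool; true; false; if_then_else_; _∨_; _∧_; not)
open import Data.List using (List; []; _∷_; length; map; concatMap; zipWith)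
open import Data.Maybe using (Maybe; just; nothing)

data Letter : Set where
  Lα Lβ Lγ Lδ : Letter

-- Type of a horizontal strip of the existing tableau (determined by the
-- leftmost tile of the strip containing a Greek letter).  Every horizontal
-- strip contains a Greek letter (its lowest-square-of-a-vertical-strip s(p,p)).
data StripType : Set where
  sβ sδ sαγ : StripType

-- Tiles of the new vertical strip above its bottom square, listed bottom to top:
--  * sq τ x : a square s(p,N+1) belonging to an old horizontal strip of type τ,
--             with content x (nothing = empty);
--  * rh x   : a short rhombus with content x; just Lα stands for "α u",
--             just Lγ for "γ q" (other letters are not allowed in short rhombi).
data Tile : Set where
  sq : StripType → Maybe Letter → Tile
  rh : Maybe Letter → Tile

countType : StripType → List StripType → ℕ
countType τ [] = 0
countType sβ (sβ ∷ ts) = suc (countType sβ ts)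
countType sδ (sδ ∷ ts) = suc (countType sδ ts)
countType sαγ (sαγ ∷ ts) = suc (countType sαγ ts)
countType τ (_ ∷ ts) = countType τ ts

contents : List (Maybe Letter)
contents = nothing ∷ just Lα ∷ just Lβ ∷ just Lγ ∷ just Lδ ∷ []

allFillings : ℕ → List (List (Maybe Letter))
allFillings zero = [] ∷ []
allFillings (suc n) = concatMap (λ x → map (x ∷_) (allFillings n)) contents

content : Tile → Maybe Letter
content (sq _ x) = x
content (rh x) = x

-- for each tile, the closest nonempty tile below it in the vertical strip
-- (its letter); the argument is the letter of the tile just below the list
seenBelow : Letter → List Tile → List Letter
seenBelow l [] = []
seenBelow l (x ∷ xs) with content x
... | nothing = l ∷ seenBelow l xs
... | just m  = l ∷ seenBelow m xs

isαγ : Letter → Bool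
isαγ Lα = true
isαγ Lγ = true
isαγ _  = false

isβδ : Letter → Bool
isβδ l = not (isαγ l)

tileOK : Tile → Letter → Bool
-- squares in β- or δ-strips lie left of a β/δ in their horizontal strip: empty
tileOK (sq sβ (just _)) _ = false
tileOK (sq sδ (just _)) _ = false
-- short rhombi contain only αu or γq
tileOK (rh (just Lβ)) _ = false
tileOK (rh (just Lδ)) _ = false
-- a nonempty tile may not lie above an α/γ in its vertical strip
tileOK (sq _ (just _)) b = isβδ b
tileOK (rh (just _)) b = isβδ b
tileOK _ _ = true

allB : List Bool → Bool
allB [] = true
allB (b ∷ bs) = b ∧ allB bs

-- the next Greek letter above the bottom δ is a β, in a square
firstIsβSquare : List Tile → Bool
firstIsβSquare [] = false
firstIsβSquare (sq _ nothing ∷ xs) = firstIsβSquare xs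
firstIsβSquare (sq _ (just Lβ) ∷ xs) = true
firstIsβSquare (sq _ (just _) ∷ xs) = false
firstIsβSquare (rh nothing ∷ xs) = firstIsβSquare xs
firstIsβSquare (rh (just _) ∷ xs) = false

-- the tiles above the bottom δ-square of the new column:
-- squares (bottom to top) for the old strips, then t short rhombi
column : List StripType → List (Maybe Letter) → List (Maybe Letter) → List Tile
column ts xs ys = zipWith sq ts xs Data.List.++ map rh ys

-- valid column of type F^(t) (at least two squares, δ at the bottom,
-- next Greek letter above it a β in a square, tableau rules)
validCol : List StripType → List (Maybe Letter) → List (Maybe Letter) → Bool
validCol ts xs ys =
  (0 <ᵇ length ts)
  ∧ firstIsβSquare (column ts xs ys)
  ∧ allB (zipWith tileOK (column ts xs ys) (seenBelow Lδ (column ts xs ys)))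

-- number of δ-strips after adding the column: the old δ-strips, the new
-- strip (bottom δ), and the α/γ-strips whose new square contains δ
newδ : List StripType → List (Maybe Letter) → ℕ
newδ [] _ = 1
newδ (sδ ∷ ts) (_ ∷ xs) = suc (newδ ts xs)
newδ (sαγ ∷ ts) (just Lδ ∷ xs) = suc (newδ ts xs)
newδ (_ ∷ ts) (_ ∷ xs) = newδ ts xs
newδ (_ ∷ ts) [] = newδ ts []

-- number of α/γ-strips after adding the column: the old α/γ-strips whose
-- new square is empty or contains α or γ
newαγ : List StripType → List (Maybe Letter) → ℕ
newαγ [] _ = 0
newαγ (sαγ ∷ ts) (nothing ∷ xs) = suc (newαγ ts xs)
newαγ (sαγ ∷ ts) (just Lα ∷ xs) = suc (newαγ ts xs)
newαγ (sαγ ∷ ts) (just Lγ ∷ xs) = suc (newαγ ts xs)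
newαγ (_ ∷ ts) (_ ∷ xs) = newαγ ts xs
newαγ (_ ∷ ts) [] = newαγ ts []

module Matrices {c ℓ} (R : CommutativeRing c ℓ)
                (α β γ δ q : CommutativeRing.Carrier R) where

  open CommutativeRing R using (Carrier; _+_; _*_; 0#; 1#)

  pow : Carrier → ℕ → Carrier
  pow x zero = 1#
  pow x (suc n) = x * pow x n

  qint : ℕ → Carrier
  qint zero = 0#
  qint (suc t) = qint t + pow q t

  sumL : List Carrier → Carrier
  sumL [] = 0#
  sumL (x ∷ xs) = x + sumL xs

  Σ< : ℕ → (ℕ → Carrier) → Carrier
  Σ< zero f = 0#
  Σ< (suc n) f = Σ< n f + f n

  cst : ℕ → Carrier
  cst t = pow q t + (α + γ * pow q t) * qint t

  mutual
    D : ℕ → ℕ → ℕ → ℕ → ℕ → Carrier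
    D t i j k l = if (j <ᵇ i) ∨ (suc k <ᵇ l) then 0# else D′ t i j k l

    D′ : ℕ → ℕ → ℕ → ℕ → ℕ → Carrier
    D′ t i j zero l =
      if (l ≡ᵇ 1) ∧ (i ≡ᵇ j) then α * pow q i
      else if (l ≡ᵇ 0) ∧ (j ≡ᵇ suc i) then δ * pow q i * cst t
      else 0#   -- "otherwise" case with k - 1 = -1: all entries 0
    D′ t i zero (suc k) zero = 0#
    D′ t i zero (suc k) (suc l) = D t i zero k l
    D′ t i (suc j) (suc k) zero = δ * (D t i j k zero + E t i j k zero)
    D′ t i (suc j) (suc k) (suc l) =
      δ * (D t i j k (suc l) + E t i j k (suc l)) + D t i (suc j) k l

    E : ℕ → ℕ → ℕ → ℕ → ℕ → Carrier
    E t i j k l = if (j <ᵇ i) ∨ (suc k <ᵇ l) then 0# else E′ t i j k l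

    E′ : ℕ → ℕ → ℕ → ℕ → ℕ → Carrier
    E′ t i j zero l =
      if (l ≡ᵇ 1) ∧ (i ≡ᵇ j) then γ * pow q (t N.+ t N.+ i)
      else if (l ≡ᵇ 0) ∧ (i ≡ᵇ j) then β * pow q i * cst t
      else 0#
    E′ t i j (suc k) zero = β * (D t i j k zero + E t i j k zero)
    E′ t i j (suc k) (suc l) =
      β * (D t i j k (suc l) + E t i j k (suc l)) + q * E t i j k l

  -- A_{i,j,k,ℓ};  j - i > k - ℓ (with ℓ ≤ k) is written i + k < j + ℓ
  mutual
    A : ℕ → ℕ → ℕ → ℕ → Carrier
    A i j k l = if (k <ᵇ l) ∨ (i N.+ k <ᵇ j N.+ l) then 0# else A′ i j k l

    A′ : ℕ → ℕ → ℕ → ℕ → Carrier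
    A′ i j zero l = if (i ≡ᵇ j) ∧ (l ≡ᵇ 0) then pow q (i N.+ i) else 0#
    A′ i zero (suc k) zero = β * A i zero k zero
    A′ i zero (suc k) (suc l) = β * A i zero k (suc l) + q * A i zero k l
    A′ i (suc j) (suc k) zero =
      β * A i (suc j) k zero + δ * q * A i j k zero
    A′ i (suc j) (suc k) (suc l) =
      β * A i (suc j) k (suc l) + δ * q * A i j k (suc l) + q * A i (suc j) k l

  -- A_{0,j-1,k,ℓ}  (0 when j = 0)
  Aprev : ℕ → ℕ → ℕ → Carrier
  Aprev zero k l = 0#
  Aprev (suc j) k l = A 0 j k l

  -- weight of a tile of the new column (u = 1), given the strip type it
  -- sees to the right (built into the tile) and the letter it sees below
  letterW : Letter → Carrier
  letterW Lα = α
  letterW Lβ = β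
  letterW Lγ = γ
  letterW Lδ = δ

  tileW : Tile → Letter → Carrier
  tileW (sq _ (just x)) _ = letterW x
  tileW (sq sβ nothing) _ = 1#
  tileW (sq sδ nothing) _ = q
  tileW (sq sαγ nothing) Lα = 1#
  tileW (sq sαγ nothing) Lδ = 1#
  tileW (sq sαγ nothing) Lβ = q
  tileW (sq sαγ nothing) Lγ = q
  tileW (rh (just Lα)) _ = α
  tileW (rh (just Lγ)) _ = γ * q
  tileW (rh (just _)) _ = 0#      -- never occurs in a valid column
  tileW (rh nothing) Lα = 1#
  tileW (rh nothing) Lγ = q * q
  tileW (rh nothing) Lβ = q
  tileW (rh nothing) Lδ = q

  prodL : List Carrier → Carrier
  prodL [] = 1#
  prodL (x ∷ xs) = x * prodL xs

  -- weight of the new column: δ (bottom square) times the tile weights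
  colW : List Tile → Carrier
  colW cs = δ * prodL (zipWith tileW cs (seenBelow Lδ cs))

  -- F^(t)_{i,a,k,b} for an existing tableau whose horizontal strips have
  -- types ts (listed in the order of their squares in the new column,
  -- bottom to top); i = #δ-strips, k = #α/γ-strips of ts.
  F : ℕ → List StripType → ℕ → ℕ → Carrier
  F t ts a b =
    sumL (concatMap (λ xs → map (λ ys →
      if validCol ts xs ys ∧ (newδ ts xs ≡ᵇ a) ∧ (newαγ ts xs ≡ᵇ b)
      then colW (column ts xs ys) else 0#)
      (allFillings t)) (allFillings (length ts)))

  -- (M M')_{0,j,k,ℓ} = Σ_{a,b} M_{0,a,k,b} M'_{a,j,b,ℓ}.  For all products
  -- below the summands vanish unless a ≤ j + k + 1 and b ≤ k + 1, so the
  -- sum is taken over a < j + k + 2, b < k + 2.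
  prod0 : (ℕ → ℕ → ℕ → ℕ → Carrier) → (ℕ → ℕ → ℕ → ℕ → Carrier)
        → ℕ → ℕ → ℕ → Carrier
  prod0 M M′ j k l =
    Σ< (suc (suc (j N.+ k))) (λ a → Σ< (suc (suc k)) (λ b → M 0 a k b * M′ a j b l))

module Submission where

-- Lemma 7.15, read off in row i = 0.  Write U, V, U′, V′ for the (j,ℓ)-arrays
-- of D^(t)A, E^(t)A, AD^(t+1), AE^(t+1) in row 0 at level k, extended by zero
-- to negative indices, and Z for row 0 of A.
--
-- FirstIdentity: U + qV = qU′ + V′, by induction on k jointly with the
--   auxiliary relation δ V′(j-1,ℓ) + V′(j,ℓ-1) = q V(j,ℓ-1) + β U′(j,ℓ).
-- Columns, ColumnSteps: F^(t) is computed by a transfer recursion over the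
--   strips, since the weight of a tile only depends on the letter it sees below.
-- Every induction step becomes a polynomial identity once multiples of the
-- induction hypotheses are added to both sides (Sums.cancel); these identities
-- are discharged by the ring solver.

open import Defs
open import Algebra.Bundles using (CommutativeRing)
open import Data.Nat using (ℕ; zero; suc; _<ᵇ_; _≡ᵇ_)
import Data.Nat as N
import Data.Nat.Properties as NP
open import Data.Integer using (ℤ; +_; -[1+_])
open import Data.Sum using (_⊎_; inj₁; inj₂)
open import Data.Bool.Properties using (T-∨)
open import Function.Bundles using (Equivalence)
open import Data.Product using (_×_; _,_; proj₁; proj₂)
open import Data.Bool using (Bool; true; false; T; if_then_else_; _∨_; _∧_)
open import Data.List using (List; []; _∷_; length; map; concatMap; zipWith; _++_)
open import Data.Maybe using (Maybe; just; nothing)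
import Relation.Binary.PropositionalEquality as P
open import Relation.Binary.PropositionalEquality using (_≡_)
open import Level using (_⊔_)

module Sums {c ℓ′} (R : CommutativeRing c ℓ′) where
  open CommutativeRing R hiding (zero)
  open import Relation.Binary.Reasoning.Setoid setoid
  open import Algebra.Solver.Ring.NaturalCoefficients.Default commutativeSemiring

  Σ< : ℕ → (ℕ → Carrier) → Carrier
  Σ< zero f = 0#
  Σ< (suc n) f = Σ< n f + f n

  Σ-cong : ∀ n {f g : ℕ → Carrier} → (∀ a → f a ≈ g a) → Σ< n f ≈ Σ< n g
  Σ-cong zero e = refl
  Σ-cong (suc n) e = +-cong (Σ-cong n e) (e n)

  Σ-+ : ∀ n (f g : ℕ → Carrier) → Σ< n (λ a → f a + g a) ≈ Σ< n f + Σ< n g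
  Σ-+ zero f g = sym (+-identityʳ 0#)
  Σ-+ (suc n) f g = begin
    Σ< n (λ a → f a + g a) + (f n + g n) ≈⟨ +-congʳ (Σ-+ n f g) ⟩
    (Σ< n f + Σ< n g) + (f n + g n)      ≈⟨ +-assoc _ _ _ ⟩
    Σ< n f + (Σ< n g + (f n + g n))      ≈⟨ +-congˡ (sym (+-assoc _ _ _)) ⟩
    Σ< n f + ((Σ< n g + f n) + g n)      ≈⟨ +-congˡ (+-congʳ (+-comm _ _)) ⟩
    Σ< n f + ((f n + Σ< n g) + g n)      ≈⟨ +-congˡ (+-assoc _ _ _) ⟩
    Σ< n f + (f n + (Σ< n g + g n))      ≈⟨ sym (+-assoc _ _ _) ⟩
    (Σ< n f + f n) + (Σ< n g + g n)      ∎

  Σ-* : ∀ n (x : Carrier) (f : ℕ → Carrier) → Σ< n (λ a → x * f a) ≈ x * Σ< n f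
  Σ-* zero x f = sym (zeroʳ x)
  Σ-* (suc n) x f = trans (+-congʳ (Σ-* n x f)) (sym (distribˡ x _ _))

  Σ-zero : ∀ n (f : ℕ → Carrier) → (∀ a → f a ≈ 0#) → Σ< n f ≈ 0#
  Σ-zero zero f e = refl
  Σ-zero (suc n) f e = trans (+-cong (Σ-zero n f e) (e n)) (+-identityʳ 0#)

  Σ-shift : ∀ n (f : ℕ → Carrier) → Σ< (suc n) f ≈ f 0 + Σ< n (λ a → f (suc a))
  Σ-shift zero f = trans (+-identityˡ _) (sym (+-identityʳ _))
  Σ-shift (suc n) f = begin
    Σ< (suc n) f + f (suc n)                   ≈⟨ +-congʳ (Σ-shift n f) ⟩
    (f 0 + Σ< n (λ a → f (suc a))) + f (suc n) ≈⟨ +-assoc _ _ _ ⟩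
    f 0 + (Σ< n (λ a → f (suc a)) + f (suc n)) ∎

  Σ-ext : ∀ n m (f : ℕ → Carrier) → n N.≤ m → (∀ a → n N.≤ a → f a ≈ 0#) → Σ< m f ≈ Σ< n f
  Σ-ext n m f n≤m vanish = P.subst (λ z → Σ< z f ≈ Σ< n f) (NP.m∸n+n≡m n≤m) (pad (m N.∸ n))
    where
    pad : ∀ d → Σ< (d N.+ n) f ≈ Σ< n f
    pad zero = refl
    pad (suc d) = trans (+-cong (pad d) (vanish (d N.+ n) (NP.m≤n+m n d))) (+-identityʳ _)

  -- cancellation: to prove a ≈ b it suffices to add equal quantities
  -- s ≈ s′ to both sides; this is how every induction step below is
  -- discharged, s and s′ being the two sides of the induction hypotheses
  cancel : ∀ {a b s s′} → a + s ≈ b + s′ → s ≈ s′ → a ≈ b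
  cancel {a} {b} {s} {s′} e e′ = begin
    a                ≈⟨ sym (+-identityʳ a) ⟩
    a + 0#           ≈⟨ +-congˡ (sym (-‿inverseʳ s)) ⟩
    a + (s - s)      ≈⟨ sym (+-assoc _ _ _) ⟩
    (a + s) - s      ≈⟨ +-congʳ e ⟩
    (b + s′) - s     ≈⟨ +-congˡ (-‿cong e′) ⟩
    (b + s′) - s′    ≈⟨ +-assoc _ _ _ ⟩
    b + (s′ - s′)    ≈⟨ +-congˡ (-‿inverseʳ s′) ⟩
    b + 0#           ≈⟨ +-identityʳ b ⟩
    b                ∎

  *-vanishes : ∀ x {y} → y ≈ 0# → x * y ≈ 0#
  *-vanishes x e = trans (*-congˡ e) (zeroʳ x)

  +-vanishes : ∀ {x y} → x ≈ 0# → y ≈ 0# → x + y ≈ 0#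
  +-vanishes ex ey = trans (+-cong ex ey) (+-identityʳ 0#)

  sub-add : ∀ a b c′ → (a - b) + (b + c′) ≈ a + c′
  sub-add a b c′ = begin
    (a + - b) + (b + c′) ≈⟨ solve 4 (λ a nb b c → (a :+ nb) :+ (b :+ c) := a :+ ((nb :+ b) :+ c)) refl a (- b) b c′ ⟩
    a + ((- b + b) + c′) ≈⟨ +-congˡ (+-congʳ (-‿inverseˡ b)) ⟩
    a + (0# + c′)        ≈⟨ +-congˡ (+-identityˡ c′) ⟩
    a + c′               ∎

  swap-sides : ∀ x {u v u′ v′} → u + x * v ≈ x * u′ + v′ → u - x * u′ ≈ v′ - x * v
  swap-sides x {u} {v} {u′} {v′} h = cancel {s = x * u′ + x * v} {s′ = x * v + x * u′}
    (trans (sub-add u (x * u′) (x * v)) (trans h (trans (+-comm _ _) (sym (sub-add v′ (x * v) (x * u′)))))) (+-comm _ _)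

  swap-sides-scaled : ∀ x {v′ v z y w a g} → v′ + g * y + x * w ≈ x * v + a * z + w → v′ - x * v ≈ a * z - g * y + (1# - x) * w
  swap-sides-scaled x {v′} {v} {z} {y} {w} {a} {g} h = cancel {s = x * v + (g * y + x * w)} {s′ = x * v + (g * y + x * w)}
    (begin
      (v′ - x * v) + (x * v + (g * y + x * w))
        ≈⟨ sub-add v′ (x * v) (g * y + x * w) ⟩
      v′ + (g * y + x * w)
        ≈⟨ sym (+-assoc _ _ _) ⟩
      v′ + g * y + x * w
        ≈⟨ h ⟩
      x * v + a * z + w
        ≈⟨ sym (trans (+-congˡ (+-cong (-‿inverseˡ (g * y)) (trans (sym (distribʳ w (- x) x)) (trans (*-congʳ (-‿inverseˡ x)) (zeroˡ w)))))
                  (trans (+-congˡ (+-identityʳ 0#)) (+-identityʳ _))) ⟩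
      (x * v + a * z + w) + (- (g * y) + g * y + (- x * w + x * w))
        ≈⟨ solve 7 (λ xv az w ngy gy nx x →
              (xv :+ az :+ w) :+ (ngy :+ gy :+ (nx :* w :+ x :* w)) := ((az :+ ngy) :+ (con 1 :+ nx) :* w) :+ (xv :+ (gy :+ x :* w)))
             refl (x * v) (a * z) w (- (g * y)) (g * y) (- x) x ⟩
      (a * z - g * y + (1# - x) * w) + (x * v + (g * y + x * w)) ∎)
    refl

-- Left factors of a product are ℕ × ℕ-indexed
-- (the middle indices a, b of (MM′)_{0,j,k,ℓ} = Σ_{a,b} M_{0,a,k,b} M′_{a,j,b,ℓ});
-- results are (j,ℓ)-arrays indexed by ℤ, vanishing at negative indices, so
-- that "j - 1" and "ℓ - 1" are total operations.
module Arrays {c ℓ′} (R : CommutativeRing c ℓ′) where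
  open CommutativeRing R hiding (zero)
  open Sums R

  ZArray : Set c
  ZArray = ℤ → ℤ → Carrier

  dec : ℤ → ℤ
  dec (+ zero) = -[1+ 0 ]
  dec (+ suc n) = + n
  dec -[1+ n ] = -[1+ suc n ]

  extend : (ℕ → ℕ → Carrier) → ZArray
  extend S (+ j) (+ l) = S j l
  extend S (+ j) -[1+ n ] = 0#
  extend S -[1+ n ] l = 0#

  NArray : Set c
  NArray = ℕ → ℕ → Carrier

  shift₁ : NArray → NArray
  shift₁ S zero b = 0#
  shift₁ S (suc a) b = S a b

  shift₂ : NArray → NArray
  shift₂ S a zero = 0#
  shift₂ S a (suc b) = S a b

  -- S vanishes outside the box [0,n) × [0,m); this lets products be
  -- computed over any large enough finite range
  Supported : ℕ → ℕ → NArray → Set _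
  Supported n m S = ∀ a b → n N.≤ a ⊎ m N.≤ b → S a b ≈ 0#

  Supported-mono : ∀ {n m n′ m′ S} → n N.≤ n′ → m N.≤ m′ → Supported n m S → Supported n′ m′ S
  Supported-mono le₁ le₂ s a b (inj₁ x) = s a b (inj₁ (NP.≤-trans le₁ x))
  Supported-mono le₁ le₂ s a b (inj₂ y) = s a b (inj₂ (NP.≤-trans le₂ y))

  Supported-shift₁ : ∀ {n m S} → Supported n m S → Supported (suc n) m (shift₁ S)
  Supported-shift₁ s zero b (inj₁ ())
  Supported-shift₁ s zero b (inj₂ y) = refl
  Supported-shift₁ s (suc a) b (inj₁ (N.s≤s x)) = s a b (inj₁ x)
  Supported-shift₁ s (suc a) b (inj₂ y) = s a b (inj₂ y)

  Supported-shift₂ : ∀ {n m S} → Supported n m S → Supported n (suc m) (shift₂ S)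
  Supported-shift₂ s a zero (inj₁ x) = refl
  Supported-shift₂ s a zero (inj₂ ())
  Supported-shift₂ s a (suc b) (inj₁ x) = s a b (inj₁ x)
  Supported-shift₂ s a (suc b) (inj₂ (N.s≤s y)) = s a b (inj₂ y)

  Supported-+ : ∀ {n m S T} → Supported n m S → Supported n m T → Supported n m (λ a b → S a b + T a b)
  Supported-+ s t a b h = trans (+-cong (s a b h) (t a b h)) (+-identityʳ _)

  Supported-* : ∀ {n m S} x → Supported n m S → Supported n m (λ a b → x * S a b)
  Supported-* x s a b h = trans (*-congˡ (s a b h)) (zeroʳ x)

  Supported-cong : ∀ {n m S T} → (∀ a b → S a b ≈ T a b) → Supported n m T → Supported n m S
  Supported-cong e s a b h = trans (e a b) (s a b h)

  Φ : ℕ → ℕ → NArray → (ℕ → ℕ → ZArray) → ZArray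
  Φ n m S RA j l = Σ< n (λ a → Σ< m (λ b → S a b * RA a b j l))

  Φ-congS : ∀ n m {S S′ RA} → (∀ a b → S a b ≈ S′ a b) → ∀ j l → Φ n m S RA j l ≈ Φ n m S′ RA j l
  Φ-congS n m e j l = Σ-cong n (λ a → Σ-cong m (λ b → *-congʳ (e a b)))

  Φ-congR : ∀ n m {S RA RB} → (∀ a b j l → RA a b j l ≈ RB a b j l) → ∀ j l → Φ n m S RA j l ≈ Φ n m S RB j l
  Φ-congR n m e j l = Σ-cong n (λ a → Σ-cong m (λ b → *-congˡ (e a b j l)))

  Φ-+S : ∀ n m S T RA j l → Φ n m (λ a b → S a b + T a b) RA j l ≈ Φ n m S RA j l + Φ n m T RA j l
  Φ-+S n m S T RA j l = trans (Σ-cong n (λ a → trans (Σ-cong m (λ b → distribʳ _ _ _)) (Σ-+ m _ _))) (Σ-+ n _ _)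

  Φ-*S : ∀ n m x S RA j l → Φ n m (λ a b → x * S a b) RA j l ≈ x * Φ n m S RA j l
  Φ-*S n m x S RA j l = trans (Σ-cong n (λ a → trans (Σ-cong m (λ b → *-assoc _ _ _)) (Σ-* m x _))) (Σ-* n x _)

  Φ-+R : ∀ n m S RA RB j l → Φ n m S (λ a b j l → RA a b j l + RB a b j l) j l ≈ Φ n m S RA j l + Φ n m S RB j l
  Φ-+R n m S RA RB j l = trans (Σ-cong n (λ a → trans (Σ-cong m (λ b → distribˡ _ _ _)) (Σ-+ m _ _))) (Σ-+ n _ _)

  Φ-*R : ∀ n m x S RA j l → Φ n m S (λ a b j l → x * RA a b j l) j l ≈ x * Φ n m S RA j l
  Φ-*R n m x S RA j l = trans (Σ-cong n (λ a → trans (Σ-cong m (λ b → swap (S a b) (RA a b j l))) (Σ-* m x _))) (Σ-* n x _)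
    where
    swap : ∀ u v → u * (x * v) ≈ x * (u * v)
    swap u v = trans (sym (*-assoc u x v)) (trans (*-congʳ (*-comm u x)) (*-assoc x u v))

  Φ-linear₅ : ∀ n m RA (S1 S2 S3 S4 S5 : NArray) c1 c2 c3 c4 j l →
    Φ n m (λ a b → S1 a b + (c1 * S2 a b + (c2 * S3 a b + (c3 * S4 a b + c4 * S5 a b)))) RA j l ≈
    Φ n m S1 RA j l + (c1 * Φ n m S2 RA j l + (c2 * Φ n m S3 RA j l + (c3 * Φ n m S4 RA j l + c4 * Φ n m S5 RA j l)))
  Φ-linear₅ n m RA S1 S2 S3 S4 S5 c1 c2 c3 c4 j l =
    trans (Φ-+S n m S1 (λ a b → c1 * S2 a b + (c2 * S3 a b + (c3 * S4 a b + c4 * S5 a b))) RA j l) (+-congˡ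
    (trans (Φ-+S n m (λ a b → c1 * S2 a b) (λ a b → c2 * S3 a b + (c3 * S4 a b + c4 * S5 a b)) RA j l) (+-cong (Φ-*S n m c1 S2 RA j l)
    (trans (Φ-+S n m (λ a b → c2 * S3 a b) (λ a b → c3 * S4 a b + c4 * S5 a b) RA j l) (+-cong (Φ-*S n m c2 S3 RA j l)
    (trans (Φ-+S n m (λ a b → c3 * S4 a b) (λ a b → c4 * S5 a b) RA j l) (+-cong (Φ-*S n m c3 S4 RA j l) (Φ-*S n m c4 S5 RA j l))))))))

  Φ-shift₁ : ∀ n m S RA j l → Φ (suc n) m (shift₁ S) RA j l ≈ Φ n m S (λ a b → RA (suc a) b) j l
  Φ-shift₁ n m S RA j l = trans (Σ-shift n _) (trans (+-congʳ (Σ-zero m _ (λ b → zeroˡ _))) (+-identityˡ _))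

  Φ-shift₂ : ∀ n m S RA j l → Φ n (suc m) (shift₂ S) RA j l ≈ Φ n m S (λ a b → RA a (suc b)) j l
  Φ-shift₂ n m S RA j l = Σ-cong n (λ a → trans (Σ-shift m _) (trans (+-congʳ (zeroˡ _)) (+-identityˡ _)))

  Φ-ext : ∀ {n m n′ m′ S} RA → Supported n m S → n N.≤ n′ → m N.≤ m′ → ∀ j l → Φ n′ m′ S RA j l ≈ Φ n m S RA j l
  Φ-ext {n} {m} {n′} {m′} {S} RA s le₁ le₂ j l =
    trans (Σ-ext n n′ _ le₁ (λ a na → Σ-zero m′ _ (λ b → trans (*-congʳ (s a b (inj₁ na))) (zeroˡ _))))
          (Σ-cong n (λ a → Σ-ext m m′ _ le₂ (λ b mb → trans (*-congʳ (s a b (inj₂ mb))) (zeroˡ _))))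

module Powers {c ℓ′} (R : CommutativeRing c ℓ′) (α β γ δ q : CommutativeRing.Carrier R) where
  open CommutativeRing R hiding (zero)
  open Matrices R α β γ δ q hiding (Σ<)
  open Sums R
  open import Relation.Binary.Reasoning.Setoid setoid
  open import Algebra.Solver.Ring.NaturalCoefficients.Default commutativeSemiring

  pow-+-suc : ∀ m n → pow q (m N.+ suc n) ≈ q * pow q (m N.+ n)
  pow-+-suc m n rewrite NP.+-suc m n = refl

  pow-double : ∀ i → pow q (suc i N.+ suc i) ≈ q * q * pow q (i N.+ i)
  pow-double i rewrite NP.+-suc i i = sym (*-assoc q q _)

  pow-+ : ∀ m n → pow q (m N.+ n) ≈ pow q m * pow q n
  pow-+ zero n = sym (*-identityˡ _)
  pow-+ (suc m) n = trans (*-congˡ (pow-+ m n)) (sym (*-assoc _ _ _))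

  pow-2t : ∀ t → pow q (t N.+ t N.+ 0) ≈ pow q t * pow q t
  pow-2t t rewrite NP.+-identityʳ (t N.+ t) = pow-+ t t

  pow-2t-suc : ∀ t → pow q (suc t N.+ suc t N.+ 0) ≈ q * q * pow q (t N.+ t N.+ 0)
  pow-2t-suc t rewrite NP.+-suc t t = sym (*-assoc _ _ _)

  qint-rel : ∀ t → q * qint t + 1# ≈ qint t + pow q t
  qint-rel zero = trans (+-congʳ (zeroʳ q)) (trans (+-identityˡ _) (sym (+-identityˡ _)))
  qint-rel (suc t) = begin
    q * (qint t + pow q t) + 1# ≈⟨ solve 4 (λ q Q P o → q :* (Q :+ P) :+ o := (q :* Q :+ o) :+ q :* P) refl q (qint t) (pow q t) 1# ⟩
    (q * qint t + 1#) + q * pow q t ≈⟨ +-congʳ (qint-rel t) ⟩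
    qint t + pow q t + q * pow q t ∎

  cst-rec : ∀ t → cst (suc t) ≈ α + q * cst t + γ * q * pow q (t N.+ t N.+ 0)
  cst-rec t = cancel {s = α * (q * qint t + 1#)} {s′ = α * (qint t + pow q t)}
    (trans (solve 5 (λ a g q Q P → (q :* P :+ (a :+ g :* (q :* P)) :* (Q :+ P)) :+ a :* (q :* Q :+ con 1)
                                 := (a :+ q :* (P :+ (a :+ g :* P) :* Q) :+ g :* q :* (P :* P)) :+ a :* (Q :+ P)) refl α γ q (qint t) (pow q t))
           (+-congʳ (+-congˡ (*-congˡ (sym (pow-2t t))))))
    (*-congˡ (qint-rel t))

-- Their definitions are guarded
-- by a vanishing region; here the recursions are shown to hold at every
-- index (inside the region both sides vanish), and the row shifts
-- i ↦ i+1, j ↦ j+1 are computed.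
module Entries {c ℓ′} (R : CommutativeRing c ℓ′) (α β γ δ q : CommutativeRing.Carrier R) where
  open CommutativeRing R hiding (zero)
  open Matrices R α β γ δ q hiding (Σ<)
  open Sums R
  open Powers R α β γ δ q
  open import Relation.Binary.Reasoning.Setoid setoid
  open import Algebra.Solver.Ring.NaturalCoefficients.Default commutativeSemiring

  unguard : ∀ b {x} → ((if b then 0# else x) ≈ x) ⊎ T b
  unguard false = inj₁ refl
  unguard true = inj₂ _

  guard-vanishes : ∀ b {x} → T b → (if b then 0# else x) ≈ 0#
  guard-vanishes true _ = refl

  data VanishA (i j k l : ℕ) : Set where
    ℓ>k : k N.< l → VanishA i j k l
    j-i>k-ℓ : i N.+ k N.< j N.+ l → VanishA i j k l

  A-unfold : ∀ i j k l → (A i j k l ≈ A′ i j k l) ⊎ VanishA i j k l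
  A-unfold i j k l with unguard ((k <ᵇ l) ∨ (i N.+ k <ᵇ j N.+ l))
  ... | inj₁ e = inj₁ e
  ... | inj₂ g with Equivalence.to T-∨ g
  ...   | inj₁ p = inj₂ (ℓ>k (NP.<ᵇ⇒< k l p))
  ...   | inj₂ p = inj₂ (j-i>k-ℓ (NP.<ᵇ⇒< (i N.+ k) (j N.+ l) p))

  A-vanishes : ∀ {i j k l} → VanishA i j k l → A i j k l ≈ 0#
  A-vanishes {i} {j} {k} {l} v = guard-vanishes ((k <ᵇ l) ∨ (i N.+ k <ᵇ j N.+ l)) (guard v)
    where
    guard : VanishA i j k l → T ((k <ᵇ l) ∨ (i N.+ k <ᵇ j N.+ l))
    guard (ℓ>k p) = Equivalence.from T-∨ (inj₁ (NP.<⇒<ᵇ p))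
    guard (j-i>k-ℓ p) = Equivalence.from T-∨ (inj₂ (NP.<⇒<ᵇ p))

  VanishA-k : ∀ {i j k l} → VanishA i j (suc k) l → VanishA i j k l
  VanishA-k (ℓ>k p) = ℓ>k (NP.<⇒≤ p)
  VanishA-k {i} {j} {k} {l} (j-i>k-ℓ p) = j-i>k-ℓ (NP.<⇒≤ (P.subst (N._< j N.+ l) (NP.+-suc i k) p))

  VanishA-jk : ∀ {i j k l} → VanishA i (suc j) (suc k) l → VanishA i j k l
  VanishA-jk (ℓ>k p) = ℓ>k (NP.<⇒≤ p)
  VanishA-jk {i} {j} {k} {l} (j-i>k-ℓ p) = j-i>k-ℓ (N.s<s⁻¹ (P.subst (N._< suc j N.+ l) (NP.+-suc i k) p))

  VanishA-kl : ∀ {i j k l} → VanishA i j (suc k) (suc l) → VanishA i j k l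
  VanishA-kl (ℓ>k p) = ℓ>k (N.s<s⁻¹ p)
  VanishA-kl {i} {j} {k} {l} (j-i>k-ℓ p) = j-i>k-ℓ (N.s<s⁻¹ (P.subst₂ N._<_ (NP.+-suc i k) (NP.+-suc j l) p))

  A-rec₀₀ : ∀ i k → A i zero (suc k) zero ≈ β * A i zero k zero
  A-rec₀₀ i k with A-unfold i zero (suc k) zero
  ... | inj₁ e = e
  ... | inj₂ v = trans (A-vanishes v) (sym (*-vanishes β (A-vanishes (VanishA-k v))))

  A-rec₀ₛ : ∀ i k l → A i zero (suc k) (suc l) ≈ β * A i zero k (suc l) + q * A i zero k l
  A-rec₀ₛ i k l with A-unfold i zero (suc k) (suc l)
  ... | inj₁ e = e
  ... | inj₂ v = trans (A-vanishes v) (sym (+-vanishes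
        (*-vanishes β (A-vanishes (VanishA-k v))) (*-vanishes q (A-vanishes (VanishA-kl v)))))

  A-recₛ₀ : ∀ i j k → A i (suc j) (suc k) zero ≈ β * A i (suc j) k zero + δ * q * A i j k zero
  A-recₛ₀ i j k with A-unfold i (suc j) (suc k) zero
  ... | inj₁ e = e
  ... | inj₂ v = trans (A-vanishes v) (sym (+-vanishes
        (*-vanishes β (A-vanishes (VanishA-k v))) (*-vanishes (δ * q) (A-vanishes (VanishA-jk v)))))

  A-recₛₛ : ∀ i j k l → A i (suc j) (suc k) (suc l) ≈ β * A i (suc j) k (suc l) + δ * q * A i j k (suc l) + q * A i (suc j) k l
  A-recₛₛ i j k l with A-unfold i (suc j) (suc k) (suc l)
  ... | inj₁ e = e
  ... | inj₂ v = trans (A-vanishes v) (sym (+-vanishes (+-vanishes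
        (*-vanishes β (A-vanishes (VanishA-k v))) (*-vanishes (δ * q) (A-vanishes (VanishA-jk v))))
        (*-vanishes q (A-vanishes (VanishA-kl v)))))

  data VanishDE (i j k l : ℕ) : Set where
    j<i : j N.< i → VanishDE i j k l
    ℓ>k+1 : suc k N.< l → VanishDE i j k l

  DE-unfold : ∀ t i j k l → ((D t i j k l ≈ D′ t i j k l) × (E t i j k l ≈ E′ t i j k l)) ⊎ VanishDE i j k l
  DE-unfold t i j k l with (j <ᵇ i) ∨ (suc k <ᵇ l) in g
  ... | false = inj₁ (refl , refl)
  ... | true with Equivalence.to T-∨ (P.subst T (P.sym g) _)
  ...   | inj₁ p = inj₂ (j<i (NP.<ᵇ⇒< j i p))
  ...   | inj₂ p = inj₂ (ℓ>k+1 (NP.<ᵇ⇒< (suc k) l p))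

  DE-guard : ∀ {i j k l} → VanishDE i j k l → T ((j <ᵇ i) ∨ (suc k <ᵇ l))
  DE-guard (j<i p) = Equivalence.from T-∨ (inj₁ (NP.<⇒<ᵇ p))
  DE-guard (ℓ>k+1 p) = Equivalence.from T-∨ (inj₂ (NP.<⇒<ᵇ p))

  D-vanishes : ∀ t {i j k l} → VanishDE i j k l → D t i j k l ≈ 0#
  D-vanishes t {i} {j} {k} {l} v = guard-vanishes ((j <ᵇ i) ∨ (suc k <ᵇ l)) (DE-guard v)

  E-vanishes : ∀ t {i j k l} → VanishDE i j k l → E t i j k l ≈ 0#
  E-vanishes t {i} {j} {k} {l} v = guard-vanishes ((j <ᵇ i) ∨ (suc k <ᵇ l)) (DE-guard v)

  VanishDE-k : ∀ {i j k l} → VanishDE i j (suc k) l → VanishDE i j k l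
  VanishDE-k (j<i p) = j<i p
  VanishDE-k (ℓ>k+1 p) = ℓ>k+1 (NP.<⇒≤ p)

  VanishDE-jk : ∀ {i j k l} → VanishDE i (suc j) (suc k) l → VanishDE i j k l
  VanishDE-jk (j<i p) = j<i (NP.<⇒≤ p)
  VanishDE-jk (ℓ>k+1 p) = ℓ>k+1 (NP.<⇒≤ p)

  VanishDE-kl : ∀ {i j k l} → VanishDE i j (suc k) (suc l) → VanishDE i j k l
  VanishDE-kl (j<i p) = j<i p
  VanishDE-kl (ℓ>k+1 p) = ℓ>k+1 (N.s<s⁻¹ p)

  D-rec₀₀ : ∀ t i k → D t i zero (suc k) zero ≈ 0#
  D-rec₀₀ t i k with DE-unfold t i zero (suc k) zero
  ... | inj₁ e = proj₁ e
  ... | inj₂ v = D-vanishes t v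

  D-rec₀ₛ : ∀ t i k l → D t i zero (suc k) (suc l) ≈ D t i zero k l
  D-rec₀ₛ t i k l with DE-unfold t i zero (suc k) (suc l)
  ... | inj₁ e = proj₁ e
  ... | inj₂ v = trans (D-vanishes t v) (sym (D-vanishes t (VanishDE-kl v)))

  D-recₛ₀ : ∀ t i j k → D t i (suc j) (suc k) zero ≈ δ * (D t i j k zero + E t i j k zero)
  D-recₛ₀ t i j k with DE-unfold t i (suc j) (suc k) zero
  ... | inj₁ e = proj₁ e
  ... | inj₂ v = trans (D-vanishes t v) (sym (*-vanishes δ (+-vanishes
        (D-vanishes t (VanishDE-jk v)) (E-vanishes t (VanishDE-jk v)))))

  D-recₛₛ : ∀ t i j k l → D t i (suc j) (suc k) (suc l) ≈ δ * (D t i j k (suc l) + E t i j k (suc l)) + D t i (suc j) k l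
  D-recₛₛ t i j k l with DE-unfold t i (suc j) (suc k) (suc l)
  ... | inj₁ e = proj₁ e
  ... | inj₂ v = trans (D-vanishes t v) (sym (+-vanishes
        (*-vanishes δ (+-vanishes (D-vanishes t (VanishDE-jk v)) (E-vanishes t (VanishDE-jk v))))
        (D-vanishes t (VanishDE-kl v))))

  E-rec₀ : ∀ t i j k → E t i j (suc k) zero ≈ β * (D t i j k zero + E t i j k zero)
  E-rec₀ t i j k with DE-unfold t i j (suc k) zero
  ... | inj₁ e = proj₂ e
  ... | inj₂ v = trans (E-vanishes t v) (sym (*-vanishes β (+-vanishes
        (D-vanishes t (VanishDE-k v)) (E-vanishes t (VanishDE-k v)))))

  E-recₛ : ∀ t i j k l → E t i j (suc k) (suc l) ≈ β * (D t i j k (suc l) + E t i j k (suc l)) + q * E t i j k l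
  E-recₛ t i j k l with DE-unfold t i j (suc k) (suc l)
  ... | inj₁ e = proj₂ e
  ... | inj₂ v = trans (E-vanishes t v) (sym (+-vanishes
        (*-vanishes β (+-vanishes (D-vanishes t (VanishDE-k v)) (E-vanishes t (VanishDE-k v))))
        (*-vanishes q (E-vanishes t (VanishDE-kl v)))))

  -- row shifts: entries depending on i only through a power of q
  if-scaled : ∀ (x : Carrier) b {u u′ v v′} → u ≈ x * v → u′ ≈ x * v′ → (if b then u else u′) ≈ x * (if b then v else v′)
  if-scaled x true e e′ = e
  if-scaled x false e e′ = e′

  pull-q : ∀ x y z → x * (q * y + q * z) ≈ q * (x * (y + z))
  pull-q x y z = solve 4 (λ x q y z → x :* (q :* y :+ q :* z) := q :* (x :* (y :+ z))) refl x q y z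

  D-shift₀ : ∀ t i j l → D t (suc i) (suc j) zero l ≈ q * D t i j zero l
  D-shift₀ t i j l = if-scaled q ((j <ᵇ i) ∨ (1 <ᵇ l)) (sym (zeroʳ q))
    (if-scaled q ((l ≡ᵇ 1) ∧ (i ≡ᵇ j)) (solve 3 (λ a q p → a :* (q :* p) := q :* (a :* p)) refl α q (pow q i))
      (if-scaled q ((l ≡ᵇ 0) ∧ (j ≡ᵇ suc i)) (solve 4 (λ d q p c → d :* (q :* p) :* c := q :* (d :* p :* c)) refl δ q (pow q i) (cst t))
        (sym (zeroʳ q))))

  E-shift₀ : ∀ t i j l → E t (suc i) (suc j) zero l ≈ q * E t i j zero l
  E-shift₀ t i j l = if-scaled q ((j <ᵇ i) ∨ (1 <ᵇ l)) (sym (zeroʳ q))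
    (if-scaled q ((l ≡ᵇ 1) ∧ (i ≡ᵇ j))
      (trans (*-congˡ (pow-+-suc (t N.+ t) i)) (solve 3 (λ a q p → a :* (q :* p) := q :* (a :* p)) refl γ q (pow q (t N.+ t N.+ i))))
      (if-scaled q ((l ≡ᵇ 0) ∧ (i ≡ᵇ j)) (solve 4 (λ d q p c → d :* (q :* p) :* c := q :* (d :* p :* c)) refl β q (pow q i) (cst t))
        (sym (zeroʳ q))))

  D-below-diagonal : ∀ t i k l → D t (suc i) zero k l ≈ 0#
  D-below-diagonal t i k l = D-vanishes t {suc i} {zero} {k} {l} (j<i N.z<s)

  E-below-diagonal : ∀ t i k l → E t (suc i) zero k l ≈ 0#
  E-below-diagonal t i k l = E-vanishes t {suc i} {zero} {k} {l} (j<i N.z<s)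

  mutual
    D-shift : ∀ t i j k l → D t (suc i) (suc j) k l ≈ q * D t i j k l
    D-shift t i j zero l = D-shift₀ t i j l
    D-shift t i zero (suc k) zero = begin
      D t (suc i) 1 (suc k) 0                       ≈⟨ D-recₛ₀ t (suc i) 0 k ⟩
      δ * (D t (suc i) 0 k 0 + E t (suc i) 0 k 0)   ≈⟨ *-vanishes δ (+-vanishes (D-below-diagonal t i k 0) (E-below-diagonal t i k 0)) ⟩
      0#                                            ≈⟨ sym (*-vanishes q (D-rec₀₀ t i k)) ⟩
      q * D t i 0 (suc k) 0                         ∎
    D-shift t i (suc j) (suc k) zero = begin
      D t (suc i) (suc (suc j)) (suc k) 0                 ≈⟨ D-recₛ₀ t (suc i) (suc j) k ⟩
      δ * (D t (suc i) (suc j) k 0 + E t (suc i) (suc j) k 0) ≈⟨ *-congˡ (+-cong (D-shift t i j k 0) (E-shift t i j k 0)) ⟩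
      δ * (q * D t i j k 0 + q * E t i j k 0)             ≈⟨ pull-q δ _ _ ⟩
      q * (δ * (D t i j k 0 + E t i j k 0))               ≈⟨ *-congˡ (sym (D-recₛ₀ t i j k)) ⟩
      q * D t i (suc j) (suc k) 0                         ∎
    D-shift t i zero (suc k) (suc l) = begin
      D t (suc i) 1 (suc k) (suc l)
        ≈⟨ D-recₛₛ t (suc i) 0 k l ⟩
      δ * (D t (suc i) 0 k (suc l) + E t (suc i) 0 k (suc l)) + D t (suc i) 1 k l
        ≈⟨ +-cong (*-vanishes δ (+-vanishes (D-below-diagonal t i k (suc l)) (E-below-diagonal t i k (suc l)))) (D-shift t i 0 k l) ⟩
      0# + q * D t i 0 k l
        ≈⟨ trans (+-identityˡ _) (*-congˡ (sym (D-rec₀ₛ t i k l))) ⟩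
      q * D t i 0 (suc k) (suc l) ∎
    D-shift t i (suc j) (suc k) (suc l) = begin
      D t (suc i) (suc (suc j)) (suc k) (suc l)
        ≈⟨ D-recₛₛ t (suc i) (suc j) k l ⟩
      δ * (D t (suc i) (suc j) k (suc l) + E t (suc i) (suc j) k (suc l)) + D t (suc i) (suc (suc j)) k l
        ≈⟨ +-cong (*-congˡ (+-cong (D-shift t i j k (suc l)) (E-shift t i j k (suc l)))) (D-shift t i (suc j) k l) ⟩
      δ * (q * D t i j k (suc l) + q * E t i j k (suc l)) + q * D t i (suc j) k l
        ≈⟨ trans (+-congʳ (pull-q δ _ _)) (sym (distribˡ q _ _)) ⟩
      q * (δ * (D t i j k (suc l) + E t i j k (suc l)) + D t i (suc j) k l)
        ≈⟨ *-congˡ (sym (D-recₛₛ t i j k l)) ⟩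
      q * D t i (suc j) (suc k) (suc l) ∎

    E-shift : ∀ t i j k l → E t (suc i) (suc j) k l ≈ q * E t i j k l
    E-shift t i j zero l = E-shift₀ t i j l
    E-shift t i j (suc k) zero = begin
      E t (suc i) (suc j) (suc k) 0                       ≈⟨ E-rec₀ t (suc i) (suc j) k ⟩
      β * (D t (suc i) (suc j) k 0 + E t (suc i) (suc j) k 0) ≈⟨ *-congˡ (+-cong (D-shift t i j k 0) (E-shift t i j k 0)) ⟩
      β * (q * D t i j k 0 + q * E t i j k 0)             ≈⟨ pull-q β _ _ ⟩
      q * (β * (D t i j k 0 + E t i j k 0))               ≈⟨ *-congˡ (sym (E-rec₀ t i j k)) ⟩
      q * E t i j (suc k) 0                               ∎
    E-shift t i j (suc k) (suc l) = begin
      E t (suc i) (suc j) (suc k) (suc l)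
        ≈⟨ E-recₛ t (suc i) (suc j) k l ⟩
      β * (D t (suc i) (suc j) k (suc l) + E t (suc i) (suc j) k (suc l)) + q * E t (suc i) (suc j) k l
        ≈⟨ +-cong (*-congˡ (+-cong (D-shift t i j k (suc l)) (E-shift t i j k (suc l)))) (*-congˡ (E-shift t i j k l)) ⟩
      β * (q * D t i j k (suc l) + q * E t i j k (suc l)) + q * (q * E t i j k l)
        ≈⟨ trans (+-congʳ (pull-q β _ _)) (sym (distribˡ q _ _)) ⟩
      q * (β * (D t i j k (suc l) + E t i j k (suc l)) + q * E t i j k l)
        ≈⟨ *-congˡ (sym (E-recₛ t i j k l)) ⟩
      q * E t i j (suc k) (suc l) ∎

  A-below-diagonal : ∀ i k l → A (suc i) zero k l ≈ 0#
  A-below-diagonal i zero l with (0 <ᵇ l) ∨ (suc (i N.+ 0) <ᵇ l)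
  ... | true = refl
  ... | false = refl
  A-below-diagonal i (suc k) zero = trans (A-rec₀₀ (suc i) k) (*-vanishes β (A-below-diagonal i k 0))
  A-below-diagonal i (suc k) (suc l) = trans (A-rec₀ₛ (suc i) k l)
    (+-vanishes (*-vanishes β (A-below-diagonal i k (suc l))) (*-vanishes q (A-below-diagonal i k l)))

  A-shift : ∀ i j k l → A (suc i) (suc j) k l ≈ q * q * A i j k l
  A-shift i j zero l = if-scaled (q * q) ((0 <ᵇ l) ∨ (i N.+ 0 <ᵇ j N.+ l)) (sym (zeroʳ _))
    (if-scaled (q * q) ((i ≡ᵇ j) ∧ (l ≡ᵇ 0)) (pow-double i) (sym (zeroʳ _)))
  A-shift i zero (suc k) zero = begin
    A (suc i) 1 (suc k) 0                                   ≈⟨ A-recₛ₀ (suc i) 0 k ⟩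
    β * A (suc i) 1 k 0 + δ * q * A (suc i) 0 k 0           ≈⟨ +-cong (*-congˡ (A-shift i 0 k 0)) (*-vanishes (δ * q) (A-below-diagonal i k 0)) ⟩
    β * (q * q * A i 0 k 0) + 0#                            ≈⟨ solve 3 (λ b q x → b :* (q :* q :* x) :+ con 0 := q :* q :* (b :* x)) refl β q _ ⟩
    q * q * (β * A i 0 k 0)                                 ≈⟨ *-congˡ (sym (A-rec₀₀ i k)) ⟩
    q * q * A i 0 (suc k) 0                                 ∎
  A-shift i zero (suc k) (suc l) = begin
    A (suc i) 1 (suc k) (suc l)
      ≈⟨ A-recₛₛ (suc i) 0 k l ⟩
    β * A (suc i) 1 k (suc l) + δ * q * A (suc i) 0 k (suc l) + q * A (suc i) 1 k l
      ≈⟨ +-cong (+-cong (*-congˡ (A-shift i 0 k (suc l))) (*-vanishes (δ * q) (A-below-diagonal i k (suc l)))) (*-congˡ (A-shift i 0 k l)) ⟩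
    β * (q * q * A i 0 k (suc l)) + 0# + q * (q * q * A i 0 k l)
      ≈⟨ solve 4 (λ b q x y → b :* (q :* q :* x) :+ con 0 :+ q :* (q :* q :* y) := q :* q :* (b :* x :+ q :* y)) refl β q _ _ ⟩
    q * q * (β * A i 0 k (suc l) + q * A i 0 k l)
      ≈⟨ *-congˡ (sym (A-rec₀ₛ i k l)) ⟩
    q * q * A i 0 (suc k) (suc l) ∎
  A-shift i (suc j) (suc k) zero = begin
    A (suc i) (suc (suc j)) (suc k) 0
      ≈⟨ A-recₛ₀ (suc i) (suc j) k ⟩
    β * A (suc i) (suc (suc j)) k 0 + δ * q * A (suc i) (suc j) k 0
      ≈⟨ +-cong (*-congˡ (A-shift i (suc j) k 0)) (*-congˡ (A-shift i j k 0)) ⟩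
    β * (q * q * A i (suc j) k 0) + δ * q * (q * q * A i j k 0)
      ≈⟨ solve 5 (λ b d q x y → b :* (q :* q :* x) :+ d :* q :* (q :* q :* y) := q :* q :* (b :* x :+ d :* q :* y)) refl β δ q _ _ ⟩
    q * q * (β * A i (suc j) k 0 + δ * q * A i j k 0)
      ≈⟨ *-congˡ (sym (A-recₛ₀ i j k)) ⟩
    q * q * A i (suc j) (suc k) 0 ∎
  A-shift i (suc j) (suc k) (suc l) = begin
    A (suc i) (suc (suc j)) (suc k) (suc l)
      ≈⟨ A-recₛₛ (suc i) (suc j) k l ⟩
    β * A (suc i) (suc (suc j)) k (suc l) + δ * q * A (suc i) (suc j) k (suc l) + q * A (suc i) (suc (suc j)) k l
      ≈⟨ +-cong (+-cong (*-congˡ (A-shift i (suc j) k (suc l))) (*-congˡ (A-shift i j k (suc l)))) (*-congˡ (A-shift i (suc j) k l)) ⟩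
    β * (q * q * A i (suc j) k (suc l)) + δ * q * (q * q * A i j k (suc l)) + q * (q * q * A i (suc j) k l)
      ≈⟨ solve 6 (λ b d q x y z → b :* (q :* q :* x) :+ d :* q :* (q :* q :* y) :+ q :* (q :* q :* z)
                                  := q :* q :* (b :* x :+ d :* q :* y :+ q :* z)) refl β δ q _ _ _ ⟩
    q * q * (β * A i (suc j) k (suc l) + δ * q * A i j k (suc l) + q * A i (suc j) k l)
      ≈⟨ *-congˡ (sym (A-recₛₛ i j k l)) ⟩
    q * q * A i (suc j) (suc k) (suc l) ∎

module Slices {c ℓ′} (R : CommutativeRing c ℓ′) (α β γ δ q : CommutativeRing.Carrier R) where
  open CommutativeRing R hiding (zero)
  open Matrices R α β γ δ q hiding (Σ<)
  open Sums R
  open Arrays R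
  open Entries R α β γ δ q

  A-slice : ℕ → ℕ → ZArray
  A-slice a b = extend (λ j l → A a j b l)

  D-slice E-slice : ℕ → ℕ → ℕ → ZArray
  D-slice t a b = extend (λ j l → D t a j b l)
  E-slice t a b = extend (λ j l → E t a j b l)

  A-rhs-zero : β * 0# + δ * q * 0# + q * 0# ≈ 0#
  A-rhs-zero = +-vanishes (+-vanishes (zeroʳ β) (zeroʳ _)) (zeroʳ q)

  D-rhs-zero : δ * (0# + 0#) + 0# ≈ 0#
  D-rhs-zero = +-vanishes (*-vanishes δ (+-identityʳ 0#)) refl

  E-rhs-zero : β * (0# + 0#) + q * 0# ≈ 0#
  E-rhs-zero = +-vanishes (*-vanishes β (+-identityʳ 0#)) (zeroʳ q)

  A-slice-rec : ∀ a b j l → A-slice a (suc b) j l ≈ β * A-slice a b j l + δ * q * A-slice a b (dec j) l + q * A-slice a b j (dec l)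
  A-slice-rec a b -[1+ n ] l = sym A-rhs-zero
  A-slice-rec a b (+ zero) -[1+ n ] = sym A-rhs-zero
  A-slice-rec a b (+ suc j) -[1+ n ] = sym A-rhs-zero
  A-slice-rec a b (+ zero) (+ zero) = trans (A-rec₀₀ a b) (sym (trans (+-assoc _ _ _) (trans (+-congˡ (+-vanishes (zeroʳ _) (zeroʳ _))) (+-identityʳ _))))
  A-slice-rec a b (+ zero) (+ suc l) = trans (A-rec₀ₛ a b l) (+-congʳ (sym (trans (+-congˡ (zeroʳ _)) (+-identityʳ _))))
  A-slice-rec a b (+ suc j) (+ zero) = trans (A-recₛ₀ a j b) (sym (trans (+-congˡ (zeroʳ _)) (+-identityʳ _)))
  A-slice-rec a b (+ suc j) (+ suc l) = A-recₛₛ a j b l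

  D-slice-rec : ∀ t a b j l → D-slice t a (suc b) j l ≈ δ * (D-slice t a b (dec j) l + E-slice t a b (dec j) l) + D-slice t a b j (dec l)
  D-slice-rec t a b -[1+ n ] l = sym D-rhs-zero
  D-slice-rec t a b (+ zero) -[1+ n ] = sym D-rhs-zero
  D-slice-rec t a b (+ suc j) -[1+ n ] = sym D-rhs-zero
  D-slice-rec t a b (+ zero) (+ zero) = trans (D-rec₀₀ t a b) (sym D-rhs-zero)
  D-slice-rec t a b (+ zero) (+ suc l) = trans (D-rec₀ₛ t a b l) (sym (trans (+-congʳ (*-vanishes δ (+-identityʳ 0#))) (+-identityˡ _)))
  D-slice-rec t a b (+ suc j) (+ zero) = trans (D-recₛ₀ t a j b) (sym (+-identityʳ _))
  D-slice-rec t a b (+ suc j) (+ suc l) = D-recₛₛ t a j b l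

  E-slice-rec : ∀ t a b j l → E-slice t a (suc b) j l ≈ β * (D-slice t a b j l + E-slice t a b j l) + q * E-slice t a b j (dec l)
  E-slice-rec t a b -[1+ n ] l = sym E-rhs-zero
  E-slice-rec t a b (+ j) -[1+ n ] = sym E-rhs-zero
  E-slice-rec t a b (+ j) (+ zero) = trans (E-rec₀ t a j b) (sym (trans (+-congˡ (zeroʳ q)) (+-identityʳ _)))
  E-slice-rec t a b (+ j) (+ suc l) = E-recₛ t a j b l

  A-slice-shift : ∀ a b j l → A-slice (suc a) b j l ≈ q * q * A-slice a b (dec j) l
  A-slice-shift a b -[1+ n ] l = sym (zeroʳ _)
  A-slice-shift a b (+ zero) -[1+ n ] = sym (zeroʳ _)
  A-slice-shift a b (+ suc j) -[1+ n ] = sym (zeroʳ _)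
  A-slice-shift a b (+ zero) (+ l) = trans (A-below-diagonal a b l) (sym (zeroʳ _))
  A-slice-shift a b (+ suc j) (+ l) = A-shift a j b l

  D-slice-shift : ∀ t a b j l → D-slice t (suc a) b j l ≈ q * D-slice t a b (dec j) l
  D-slice-shift t a b -[1+ n ] l = sym (zeroʳ _)
  D-slice-shift t a b (+ zero) -[1+ n ] = sym (zeroʳ _)
  D-slice-shift t a b (+ suc j) -[1+ n ] = sym (zeroʳ _)
  D-slice-shift t a b (+ zero) (+ l) = trans (D-below-diagonal t a b l) (sym (zeroʳ _))
  D-slice-shift t a b (+ suc j) (+ l) = D-shift t a j b l

  E-slice-shift : ∀ t a b j l → E-slice t (suc a) b j l ≈ q * E-slice t a b (dec j) l
  E-slice-shift t a b -[1+ n ] l = sym (zeroʳ _)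
  E-slice-shift t a b (+ zero) -[1+ n ] = sym (zeroʳ _)
  E-slice-shift t a b (+ suc j) -[1+ n ] = sym (zeroʳ _)
  E-slice-shift t a b (+ zero) (+ l) = trans (E-below-diagonal t a b l) (sym (zeroʳ _))
  E-slice-shift t a b (+ suc j) (+ l) = E-shift t a j b l

  D-row E-row : ℕ → ℕ → NArray
  D-row t k a b = D t 0 a k b
  E-row t k a b = E t 0 a k b

  A-row : ℕ → NArray
  A-row k a b = A 0 a k b

  D-row-rec : ∀ t k a b → D-row t (suc k) a b ≈ δ * shift₁ (λ a b → D-row t k a b + E-row t k a b) a b + shift₂ (D-row t k) a b
  D-row-rec t k zero zero = trans (D-rec₀₀ t 0 k) (sym (trans (+-congʳ (zeroʳ δ)) (+-identityʳ _)))
  D-row-rec t k zero (suc b) = trans (D-rec₀ₛ t 0 k b) (sym (trans (+-congʳ (zeroʳ δ)) (+-identityˡ _)))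
  D-row-rec t k (suc a) zero = trans (D-recₛ₀ t 0 a k) (sym (+-identityʳ _))
  D-row-rec t k (suc a) (suc b) = D-recₛₛ t 0 a k b

  E-row-rec : ∀ t k a b → E-row t (suc k) a b ≈ β * (D-row t k a b + E-row t k a b) + q * shift₂ (E-row t k) a b
  E-row-rec t k a zero = trans (E-rec₀ t 0 a k) (sym (trans (+-congˡ (zeroʳ q)) (+-identityʳ _)))
  E-row-rec t k a (suc b) = E-recₛ t 0 a k b

  A-row-rec : ∀ k a b → A-row (suc k) a b ≈ β * A-row k a b + δ * q * shift₁ (A-row k) a b + q * shift₂ (A-row k) a b
  A-row-rec k zero zero = trans (A-rec₀₀ 0 k) (sym (trans (+-assoc _ _ _) (trans (+-congˡ (+-vanishes (zeroʳ _) (zeroʳ _))) (+-identityʳ _))))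
  A-row-rec k zero (suc b) = trans (A-rec₀ₛ 0 k b) (+-congʳ (sym (trans (+-congˡ (zeroʳ _)) (+-identityʳ _))))
  A-row-rec k (suc a) zero = trans (A-recₛ₀ 0 a k) (sym (trans (+-congˡ (zeroʳ _)) (+-identityʳ _)))
  A-row-rec k (suc a) (suc b) = A-recₛₛ 0 a k b

  size : ℕ → ℕ
  size k = suc (suc k)

  Box : ℕ → NArray → Set _
  Box k = Supported (size k) (size k)

  DE-row-supported : ∀ t k → Box k (D-row t k) × Box k (E-row t k)
  DE-row-supported t zero = D₀ , E₀
    where
    D₀ : Box 0 (D-row t 0)
    D₀ a b (inj₂ h) = D-vanishes t {0} {a} {0} {b} (ℓ>k+1 h)
    D₀ zero b (inj₁ ())
    D₀ (suc zero) b (inj₁ (N.s≤s ()))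
    D₀ (suc (suc a)) zero (inj₁ h) = refl
    D₀ (suc (suc a)) (suc zero) (inj₁ h) = refl
    D₀ (suc (suc a)) (suc (suc b)) (inj₁ h) = D-vanishes t {0} {suc (suc a)} {0} {suc (suc b)} (ℓ>k+1 (N.s≤s (N.s≤s N.z≤n)))
    E₀ : Box 0 (E-row t 0)
    E₀ a b (inj₂ h) = E-vanishes t {0} {a} {0} {b} (ℓ>k+1 h)
    E₀ zero b (inj₁ ())
    E₀ (suc zero) b (inj₁ (N.s≤s ()))
    E₀ (suc (suc a)) zero (inj₁ h) = refl
    E₀ (suc (suc a)) (suc zero) (inj₁ h) = refl
    E₀ (suc (suc a)) (suc (suc b)) (inj₁ h) = E-vanishes t {0} {suc (suc a)} {0} {suc (suc b)} (ℓ>k+1 (N.s≤s (N.s≤s N.z≤n)))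
  DE-row-supported t (suc k) =
    Supported-cong (D-row-rec t k) (Supported-+ (Supported-* δ (Supported-mono NP.≤-refl (NP.n≤1+n _) (Supported-shift₁ sDE)))
                                                (Supported-mono (NP.n≤1+n _) NP.≤-refl (Supported-shift₂ sD))) ,
    Supported-cong (E-row-rec t k) (Supported-+ (Supported-* β (Supported-mono (NP.n≤1+n _) (NP.n≤1+n _) sDE))
                                                (Supported-* q (Supported-mono (NP.n≤1+n _) NP.≤-refl (Supported-shift₂ sE))))
    where
    sD = proj₁ (DE-row-supported t k)
    sE = proj₂ (DE-row-supported t k)
    sDE = Supported-+ sD sE

  A-row-supported : ∀ k → Supported (suc k) (suc k) (A-row k)
  A-row-supported zero (suc a) zero h = refl
  A-row-supported zero a (suc b) h = refl
  A-row-supported zero zero zero (inj₁ ())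
  A-row-supported zero zero zero (inj₂ ())
  A-row-supported (suc k) = Supported-cong (A-row-rec k)
    (Supported-+ (Supported-+ (Supported-* β (Supported-mono (NP.n≤1+n _) (NP.n≤1+n _) sA))
                              (Supported-* (δ * q) (Supported-mono NP.≤-refl (NP.n≤1+n _) (Supported-shift₁ sA))))
                 (Supported-* q (Supported-mono (NP.n≤1+n _) NP.≤-refl (Supported-shift₂ sA))))
    where sA = A-row-supported k

-- The matrices D^(t)A, E^(t)A, AD^(t+1), AE^(t+1) at row 0 and level k
-- are the arrays U k, V k, U′ k, V′ k; Z k is row 0 of A itself.
module Products {c ℓ′} (R : CommutativeRing c ℓ′) (α β γ δ q : CommutativeRing.Carrier R) where
  open CommutativeRing R hiding (zero)
  open Matrices R α β γ δ q renaming (Σ< to Σ<′)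
  open Sums R
  open Arrays R
  open Slices R α β γ δ q
  open import Relation.Binary.Reasoning.Setoid setoid

  grow : ∀ {n} → n N.≤ suc n
  grow {n} = NP.n≤1+n n

  Σ<-agrees : ∀ n f → Σ<′ n f ≈ Σ< n f
  Σ<-agrees zero f = refl
  Σ<-agrees (suc n) f = +-congʳ (Σ<-agrees n f)

  prod0≈Φ : ∀ (M M′ : ℕ → ℕ → ℕ → ℕ → Carrier) j k l →
    prod0 M M′ j k l ≈ Φ (suc (suc (j N.+ k))) (size k) (λ a b → M 0 a k b) (λ a b → extend (λ j l → M′ a j b l)) (+ j) (+ l)
  prod0≈Φ M M′ j k l = trans (Σ<-agrees (suc (suc (j N.+ k))) _) (Σ-cong (suc (suc (j N.+ k))) (λ a → Σ<-agrees (size k) _))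

  Φ-shift₁-A : ∀ n m S j l → Φ (suc n) m (shift₁ S) A-slice j l ≈ q * q * Φ n m S A-slice (dec j) l
  Φ-shift₁-A n m S j l = trans (Φ-shift₁ n m S A-slice j l) (trans (Φ-congR n m (λ a b j l → A-slice-shift a b j l) j l) (Φ-*R n m (q * q) S (λ a b j l → A-slice a b (dec j) l) j l))

  Φ-shift₂-A : ∀ n m S j l → Φ n (suc m) (shift₂ S) A-slice j l ≈ β * Φ n m S A-slice j l + δ * q * Φ n m S A-slice (dec j) l + q * Φ n m S A-slice j (dec l)
  Φ-shift₂-A n m S j l = trans (Φ-shift₂ n m S A-slice j l) (trans (Φ-congR n m (λ a b j l → A-slice-rec a b j l) j l)
    (trans (Φ-+R n m S (λ a b j l → β * A-slice a b j l + δ * q * A-slice a b (dec j) l) (λ a b j l → q * A-slice a b j (dec l)) j l)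
      (+-cong (trans (Φ-+R n m S (λ a b j l → β * A-slice a b j l) (λ a b j l → δ * q * A-slice a b (dec j) l) j l)
                 (+-cong (Φ-*R n m β S A-slice j l) (Φ-*R n m (δ * q) S (λ a b j l → A-slice a b (dec j) l) j l)))
      (Φ-*R n m q S (λ a b j l → A-slice a b j (dec l)) j l))))

  Φ-shift₁-D : ∀ t n m S j l → Φ (suc n) m (shift₁ S) (D-slice t) j l ≈ q * Φ n m S (D-slice t) (dec j) l
  Φ-shift₁-D t n m S j l = trans (Φ-shift₁ n m S (D-slice t) j l) (trans (Φ-congR n m (λ a b j l → D-slice-shift t a b j l) j l) (Φ-*R n m q S (λ a b j l → D-slice t a b (dec j) l) j l))

  Φ-shift₁-E : ∀ t n m S j l → Φ (suc n) m (shift₁ S) (E-slice t) j l ≈ q * Φ n m S (E-slice t) (dec j) l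
  Φ-shift₁-E t n m S j l = trans (Φ-shift₁ n m S (E-slice t) j l) (trans (Φ-congR n m (λ a b j l → E-slice-shift t a b j l) j l) (Φ-*R n m q S (λ a b j l → E-slice t a b (dec j) l) j l))

  Φ-shift₂-D : ∀ t n m S j l → Φ n (suc m) (shift₂ S) (D-slice t) j l ≈ δ * (Φ n m S (D-slice t) (dec j) l + Φ n m S (E-slice t) (dec j) l) + Φ n m S (D-slice t) j (dec l)
  Φ-shift₂-D t n m S j l = trans (Φ-shift₂ n m S (D-slice t) j l) (trans (Φ-congR n m (λ a b j l → D-slice-rec t a b j l) j l)
    (trans (Φ-+R n m S (λ a b j l → δ * (D-slice t a b (dec j) l + E-slice t a b (dec j) l)) (λ a b j l → D-slice t a b j (dec l)) j l)
      (+-congʳ (trans (Φ-*R n m δ S (λ a b j l → D-slice t a b (dec j) l + E-slice t a b (dec j) l) j l)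
        (*-congˡ (Φ-+R n m S (λ a b j l → D-slice t a b (dec j) l) (λ a b j l → E-slice t a b (dec j) l) j l))))))

  Φ-shift₂-E : ∀ t n m S j l → Φ n (suc m) (shift₂ S) (E-slice t) j l ≈ β * (Φ n m S (D-slice t) j l + Φ n m S (E-slice t) j l) + q * Φ n m S (E-slice t) j (dec l)
  Φ-shift₂-E t n m S j l = trans (Φ-shift₂ n m S (E-slice t) j l) (trans (Φ-congR n m (λ a b j l → E-slice-rec t a b j l) j l)
    (trans (Φ-+R n m S (λ a b j l → β * (D-slice t a b j l + E-slice t a b j l)) (λ a b j l → q * E-slice t a b j (dec l)) j l)
      (+-cong (trans (Φ-*R n m β S (λ a b j l → D-slice t a b j l + E-slice t a b j l) j l) (*-congˡ (Φ-+R n m S (D-slice t) (E-slice t) j l)))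
        (Φ-*R n m q S (λ a b j l → E-slice t a b j (dec l)) j l))))

  ΦA : ℕ → NArray → ZArray
  ΦA k P = Φ (size k) (size k) P A-slice

  ΦA-grow : ∀ k P → Box k P → ∀ j l → Φ (size (suc k)) (size (suc k)) P A-slice j l ≈ ΦA k P j l
  ΦA-grow k P s = Φ-ext A-slice s grow grow

  ΦA-shift₂ : ∀ k P → Box k P → ∀ j l → Φ (size (suc k)) (size (suc k)) (shift₂ P) A-slice j l ≈ β * ΦA k P j l + δ * q * ΦA k P (dec j) l + q * ΦA k P j (dec l)
  ΦA-shift₂ k P s j l = trans (Φ-shift₂-A (size (suc k)) (size k) P j l) (+-cong (+-cong (*-congˡ (shrink j l)) (*-congˡ (shrink (dec j) l))) (*-congˡ (shrink j (dec l))))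
    where
    shrink : ∀ j l → Φ (size (suc k)) (size k) P A-slice j l ≈ ΦA k P j l
    shrink = Φ-ext A-slice s grow NP.≤-refl

  ΦA-shift₁ : ∀ k P → Box k P → ∀ j l → Φ (size (suc k)) (size (suc k)) (shift₁ P) A-slice j l ≈ q * q * ΦA k P (dec j) l
  ΦA-shift₁ k P s j l = trans (Φ-shift₁-A (size k) (size (suc k)) P j l) (*-congˡ (Φ-ext A-slice s NP.≤-refl grow (dec j) l))

  module _ (t : ℕ) where
    U V U′ V′ : ℕ → ZArray
    U k = ΦA k (D-row t k)
    V k = ΦA k (E-row t k)
    U′ k = Φ (size k) (size k) (A-row k) (D-slice (suc t))
    V′ k = Φ (size k) (size k) (A-row k) (E-slice (suc t))

    Z : ℕ → ZArray
    Z k = A-slice 0 k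

    sD : ∀ k → Box k (D-row t k)
    sD k = proj₁ (DE-row-supported t k)
    sE : ∀ k → Box k (E-row t k)
    sE k = proj₂ (DE-row-supported t k)
    sA : ∀ k → Box k (A-row k)
    sA k = Supported-mono grow grow (A-row-supported k)
    sDE : ∀ k → Box k (λ a b → D-row t k a b + E-row t k a b)
    sDE k = Supported-+ (sD k) (sE k)

    U-rec : ∀ k j l → U (suc k) j l ≈ δ * (q * q * (U k (dec j) l + V k (dec j) l)) + (β * U k j l + δ * q * U k (dec j) l + q * U k j (dec l))
    U-rec k j l = begin
      U (suc k) j l
        ≈⟨ Φ-congS (size (suc k)) (size (suc k)) {RA = A-slice} (D-row-rec t k) j l ⟩
      Φ (size (suc k)) (size (suc k)) (λ a b → δ * shift₁ DE a b + shift₂ (D-row t k) a b) A-slice j l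
        ≈⟨ Φ-+S (size (suc k)) (size (suc k)) _ _ A-slice j l ⟩
      Φ (size (suc k)) (size (suc k)) (λ a b → δ * shift₁ DE a b) A-slice j l + Φ (size (suc k)) (size (suc k)) (shift₂ (D-row t k)) A-slice j l
        ≈⟨ +-cong (trans (Φ-*S (size (suc k)) (size (suc k)) δ (shift₁ DE) A-slice j l) (*-congˡ (ΦA-shift₁ k DE (sDE k) j l)))
                  (ΦA-shift₂ k (D-row t k) (sD k) j l) ⟩
      δ * (q * q * ΦA k DE (dec j) l) + (β * U k j l + δ * q * U k (dec j) l + q * U k j (dec l))
        ≈⟨ +-congʳ (*-congˡ (*-congˡ (Φ-+S (size k) (size k) _ _ A-slice (dec j) l))) ⟩
      δ * (q * q * (U k (dec j) l + V k (dec j) l)) + (β * U k j l + δ * q * U k (dec j) l + q * U k j (dec l)) ∎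
      where
      DE : NArray
      DE a b = D-row t k a b + E-row t k a b

    V-rec : ∀ k j l → V (suc k) j l ≈ β * (U k j l + V k j l) + q * (β * V k j l + δ * q * V k (dec j) l + q * V k j (dec l))
    V-rec k j l = begin
      V (suc k) j l
        ≈⟨ Φ-congS (size (suc k)) (size (suc k)) {RA = A-slice} (E-row-rec t k) j l ⟩
      Φ (size (suc k)) (size (suc k)) (λ a b → β * DE a b + q * shift₂ (E-row t k) a b) A-slice j l
        ≈⟨ Φ-+S (size (suc k)) (size (suc k)) _ _ A-slice j l ⟩
      Φ (size (suc k)) (size (suc k)) (λ a b → β * DE a b) A-slice j l + Φ (size (suc k)) (size (suc k)) (λ a b → q * shift₂ (E-row t k) a b) A-slice j l
        ≈⟨ +-cong (trans (Φ-*S (size (suc k)) (size (suc k)) β DE A-slice j l)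
                         (*-congˡ (trans (ΦA-grow k DE (sDE k) j l) (Φ-+S (size k) (size k) _ _ A-slice j l))))
                  (trans (Φ-*S (size (suc k)) (size (suc k)) q (shift₂ (E-row t k)) A-slice j l) (*-congˡ (ΦA-shift₂ k (E-row t k) (sE k) j l))) ⟩
      β * (U k j l + V k j l) + q * (β * V k j l + δ * q * V k (dec j) l + q * V k j (dec l)) ∎
      where
      DE : NArray
      DE a b = D-row t k a b + E-row t k a b

    Φ-A-row-rec : ∀ k RA j l → Φ (size (suc k)) (size (suc k)) (A-row (suc k)) RA j l ≈
      β * Φ (size (suc k)) (size (suc k)) (A-row k) RA j l + δ * q * Φ (size (suc k)) (size (suc k)) (shift₁ (A-row k)) RA j l + q * Φ (size (suc k)) (size (suc k)) (shift₂ (A-row k)) RA j l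
    Φ-A-row-rec k RA j l = trans (Φ-congS (size (suc k)) (size (suc k)) {RA = RA} (A-row-rec k) j l) (trans (Φ-+S (size (suc k)) (size (suc k)) _ _ RA j l) (+-cong (trans (Φ-+S (size (suc k)) (size (suc k)) _ _ RA j l)
      (+-cong (Φ-*S (size (suc k)) (size (suc k)) β (A-row k) RA j l) (Φ-*S (size (suc k)) (size (suc k)) (δ * q) (shift₁ (A-row k)) RA j l))) (Φ-*S (size (suc k)) (size (suc k)) q (shift₂ (A-row k)) RA j l)))

    A-row-ext : ∀ k RA {n m} → size k N.≤ n → size k N.≤ m → ∀ j l → Φ n m (A-row k) RA j l ≈ Φ (size k) (size k) (A-row k) RA j l
    A-row-ext k RA = Φ-ext RA (sA k)

    U′-rec : ∀ k j l → U′ (suc k) j l ≈ β * U′ k j l + δ * q * (q * U′ k (dec j) l) + q * (δ * (U′ k (dec j) l + V′ k (dec j) l) + U′ k j (dec l))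
    U′-rec k j l = trans (Φ-A-row-rec k (D-slice (suc t)) j l)
      (+-cong (+-cong (*-congˡ (A-row-ext k (D-slice (suc t)) grow grow j l))
                      (*-congˡ (trans (Φ-shift₁-D (suc t) (size k) (size (suc k)) (A-row k) j l) (*-congˡ (A-row-ext k (D-slice (suc t)) NP.≤-refl grow (dec j) l)))))
        (*-congˡ (trans (Φ-shift₂-D (suc t) (size (suc k)) (size k) (A-row k) j l)
          (+-cong (*-congˡ (+-cong (A-row-ext k (D-slice (suc t)) grow NP.≤-refl (dec j) l) (A-row-ext k (E-slice (suc t)) grow NP.≤-refl (dec j) l)))
                  (A-row-ext k (D-slice (suc t)) grow NP.≤-refl j (dec l))))))

    V′-rec : ∀ k j l → V′ (suc k) j l ≈ β * V′ k j l + δ * q * (q * V′ k (dec j) l) + q * (β * (U′ k j l + V′ k j l) + q * V′ k j (dec l))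
    V′-rec k j l = trans (Φ-A-row-rec k (E-slice (suc t)) j l)
      (+-cong (+-cong (*-congˡ (A-row-ext k (E-slice (suc t)) grow grow j l))
                      (*-congˡ (trans (Φ-shift₁-E (suc t) (size k) (size (suc k)) (A-row k) j l) (*-congˡ (A-row-ext k (E-slice (suc t)) NP.≤-refl grow (dec j) l)))))
        (*-congˡ (trans (Φ-shift₂-E (suc t) (size (suc k)) (size k) (A-row k) j l)
          (+-cong (*-congˡ (+-cong (A-row-ext k (D-slice (suc t)) grow NP.≤-refl j l) (A-row-ext k (E-slice (suc t)) grow NP.≤-refl j l)))
                  (*-congˡ (A-row-ext k (E-slice (suc t)) grow NP.≤-refl j (dec l)))))))

    Z-rec : ∀ k j l → Z (suc k) j l ≈ β * Z k j l + δ * q * Z k (dec j) l + q * Z k j (dec l)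
    Z-rec k = A-slice-rec 0 k

    DA≈U : ∀ j k l → prod0 (D t) A j k l ≈ U k (+ j) (+ l)
    DA≈U j k l = trans (prod0≈Φ (D t) A j k l) (Φ-ext A-slice (sD k) (N.s≤s (N.s≤s (NP.m≤n+m k j))) NP.≤-refl (+ j) (+ l))
    EA≈V : ∀ j k l → prod0 (E t) A j k l ≈ V k (+ j) (+ l)
    EA≈V j k l = trans (prod0≈Φ (E t) A j k l) (Φ-ext A-slice (sE k) (N.s≤s (N.s≤s (NP.m≤n+m k j))) NP.≤-refl (+ j) (+ l))
    AD≈U′ : ∀ j k l → prod0 A (D (suc t)) j k l ≈ U′ k (+ j) (+ l)
    AD≈U′ j k l = trans (prod0≈Φ A (D (suc t)) j k l) (Φ-ext (D-slice (suc t)) (sA k) (N.s≤s (N.s≤s (NP.m≤n+m k j))) NP.≤-refl (+ j) (+ l))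
    AE≈V′ : ∀ j k l → prod0 A (E (suc t)) j k l ≈ V′ k (+ j) (+ l)
    AE≈V′ j k l = trans (prod0≈Φ A (E (suc t)) j k l) (Φ-ext (E-slice (suc t)) (sA k) (N.s≤s (N.s≤s (NP.m≤n+m k j))) NP.≤-refl (+ j) (+ l))

-- In the solver calls a
-- variable u, uʲ, uˡ, uʲˡ, ... stands for the array U at (j,ℓ), (j-1,ℓ),
-- (j,ℓ-1), (j-1,ℓ-1), ..., and similarly for the other arrays.
module FirstIdentity {c ℓ′} (R : CommutativeRing c ℓ′) (α β γ δ q : CommutativeRing.Carrier R) where
  open CommutativeRing R hiding (zero)
  open Matrices R α β γ δ q hiding (Σ<)
  open Sums R
  open Arrays R
  open Powers R α β γ δ q
  open Slices R α β γ δ q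
  open Products R α β γ δ q
  open import Relation.Binary.Reasoning.Setoid setoid
  open import Algebra.Solver.Ring.NaturalCoefficients.Default commutativeSemiring

  Z₀ : ZArray
  Z₀ = A-slice 0 0

  r00 : ∀ x y → 0# ≈ x * 0# + y * 0#
  r00 x y = solve 2 (λ x y → con 0 := x :* con 0 :+ y :* con 0) refl x y
  r10 : ∀ x y → x * 1# ≈ x * 1# + y * 0#
  r10 x y = solve 2 (λ x y → x :* con 1 := x :* con 1 :+ y :* con 0) refl x y
  rd : ∀ a d c → d * 1# * c ≈ a * 0# + d * c * 1#
  rd a d c = solve 3 (λ a d c → d :* con 1 :* c := a :* con 0 :+ d :* c :* con 1) refl a d c
  re : ∀ x y → x ≈ x * 1# + y * 0#
  re x y = solve 2 (λ x y → x := x :* con 1 :+ y :* con 0) refl x y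

  DE-base : ∀ t j l → (D-slice t 0 0 j l ≈ α * Z₀ j (dec l) + δ * cst t * Z₀ (dec j) l) × (E-slice t 0 0 j l ≈ γ * pow q (t N.+ t N.+ 0) * Z₀ j (dec l) + β * cst t * Z₀ j l)
  DE-base t -[1+ n ] l = r00 _ _ , r00 _ _
  DE-base t (+ zero) -[1+ n ] = r00 _ _ , r00 _ _
  DE-base t (+ suc j) -[1+ n ] = r00 _ _ , r00 _ _
  DE-base t (+ zero) (+ zero) = r00 _ _ , rd _ _ _
  DE-base t (+ zero) (+ suc zero) = r10 _ _ , re _ _
  DE-base t (+ zero) (+ suc (suc l)) = r00 _ _ , r00 _ _
  DE-base t (+ suc zero) (+ zero) = rd _ _ _ , r00 _ _
  DE-base t (+ suc zero) (+ suc zero) = r00 _ _ , r00 _ _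
  DE-base t (+ suc zero) (+ suc (suc l)) = r00 _ _ , r00 _ _
  DE-base t (+ suc (suc j)) (+ zero) = r00 _ _ , r00 _ _
  DE-base t (+ suc (suc j)) (+ suc zero) = r00 _ _ , r00 _ _
  DE-base t (+ suc (suc j)) (+ suc (suc l)) = r00 _ _ , r00 _ _

  module _ (t : ℕ) where
    -- Rel₁ is the first identity; Rel₂ is the auxiliary relation needed to
    -- carry the induction on k
    Rel₁ Rel₂ : ℕ → ℤ → ℤ → Set _
    Rel₁ k j l = U t k j l + q * V t k j l ≈ q * U′ t k j l + V′ t k j l
    Rel₂ k j l = δ * V′ t k (dec j) l + V′ t k j (dec l) ≈ q * V t k j (dec l) + β * U′ t k j l

    U₀ : ∀ j l → U t 0 j l ≈ α * (β * Z₀ j l + δ * q * Z₀ (dec j) l + q * Z₀ j (dec l)) + δ * cst t * (q * q * Z₀ (dec j) l)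
    U₀ j l = trans (solve 7 (λ a d c x00 x01 x10 x11 → (con 0 :+ ((con 0 :+ con 0 :* x00) :+ a :* con 1 :* x01)) :+ ((con 0 :+ d :* con 1 :* c :* x10) :+ con 0 :* x11) := a :* x01 :+ d :* c :* x10) refl α δ (cst t) (A-slice 0 0 j l) (A-slice 0 1 j l) (A-slice 1 0 j l) (A-slice 1 1 j l))
      (+-cong (*-congˡ (A-slice-rec 0 0 j l)) (*-congˡ (A-slice-shift 0 0 j l)))

    V₀ : ∀ j l → V t 0 j l ≈ β * cst t * Z₀ j l + γ * pow q (t N.+ t N.+ 0) * (β * Z₀ j l + δ * q * Z₀ (dec j) l + q * Z₀ j (dec l))
    V₀ j l = trans (solve 7 (λ b g c x00 x01 x10 x11 → (con 0 :+ ((con 0 :+ b :* con 1 :* c :* x00) :+ g :* x01)) :+ ((con 0 :+ con 0 :* x10) :+ con 0 :* x11) := b :* c :* x00 :+ g :* x01) refl β (γ * pow q (t N.+ t N.+ 0)) (cst t) (A-slice 0 0 j l) (A-slice 0 1 j l) (A-slice 1 0 j l) (A-slice 1 1 j l))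
      (+-congˡ (*-congˡ (A-slice-rec 0 0 j l)))

    U′₀ : ∀ j l → U′ t 0 j l ≈ α * Z₀ j (dec l) + δ * (α + q * cst t + γ * q * pow q (t N.+ t N.+ 0)) * Z₀ (dec j) l
    U′₀ j l = trans (solve 4 (λ x00 x01 x10 x11 → (con 0 :+ ((con 0 :+ con 1 :* x00) :+ con 0 :* x01)) :+ ((con 0 :+ con 0 :* x10) :+ con 0 :* x11) := x00) refl (D-slice (suc t) 0 0 j l) (D-slice (suc t) 0 1 j l) (D-slice (suc t) 1 0 j l) (D-slice (suc t) 1 1 j l))
      (trans (proj₁ (DE-base (suc t) j l)) (+-congˡ (*-congʳ (*-congˡ (cst-rec t)))))

    V′₀ : ∀ j l → V′ t 0 j l ≈ γ * (q * q * pow q (t N.+ t N.+ 0)) * Z₀ j (dec l) + β * (α + q * cst t + γ * q * pow q (t N.+ t N.+ 0)) * Z₀ j l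
    V′₀ j l = trans (solve 4 (λ x00 x01 x10 x11 → (con 0 :+ ((con 0 :+ con 1 :* x00) :+ con 0 :* x01)) :+ ((con 0 :+ con 0 :* x10) :+ con 0 :* x11) := x00) refl (E-slice (suc t) 0 0 j l) (E-slice (suc t) 0 1 j l) (E-slice (suc t) 1 0 j l) (E-slice (suc t) 1 1 j l))
      (trans (proj₂ (DE-base (suc t) j l)) (+-cong (*-congʳ (*-congˡ (pow-2t-suc t))) (*-congʳ (*-congˡ (cst-rec t)))))

    Rel₁-base : ∀ j l → Rel₁ 0 j l
    Rel₁-base j l = trans (+-cong (U₀ j l) (*-congˡ (V₀ j l))) (trans
      (solve 10 (λ a b z d q zʲ zˡ c g p → (((a :* (((b :* z) :+ ((d :* q) :* zʲ)) :+ (q :* zˡ))) :+ ((d :* c) :* ((q :* q) :* zʲ))) :+ (q :* (((b :* c) :* z) :+ ((g :* p) :* (((b :* z) :+ ((d :* q) :* zʲ)) :+ (q :* zˡ)))))) := ((q :* ((a :* zˡ) :+ ((d :* ((a :+ (q :* c)) :+ ((g :* q) :* p))) :* zʲ))) :+ (((g :* ((q :* q) :* p)) :* zˡ) :+ ((b :* ((a :+ (q :* c)) :+ ((g :* q) :* p))) :* z)))) refl (α) (β) (Z₀ j l) (δ) (q) (Z₀ (dec j) l) (Z₀ j (dec l)) (cst t) (γ) (pow q (t N.+ t N.+ 0)))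
      (sym (+-cong (*-congˡ (U′₀ j l)) (V′₀ j l))))

    Rel₂-base : ∀ j l → Rel₂ 0 j l
    Rel₂-base j l = trans (+-cong (*-congˡ (V′₀ (dec j) l)) (V′₀ j (dec l))) (trans
      (solve 11 (λ d g q p zʲˡ b a c zʲ zˡˡ zˡ → ((d :* (((g :* ((q :* q) :* p)) :* zʲˡ) :+ ((b :* ((a :+ (q :* c)) :+ ((g :* q) :* p))) :* zʲ))) :+ (((g :* ((q :* q) :* p)) :* zˡˡ) :+ ((b :* ((a :+ (q :* c)) :+ ((g :* q) :* p))) :* zˡ))) := ((q :* (((b :* c) :* zˡ) :+ ((g :* p) :* (((b :* zˡ) :+ ((d :* q) :* zʲˡ)) :+ (q :* zˡˡ))))) :+ (b :* ((a :* zˡ) :+ ((d :* ((a :+ (q :* c)) :+ ((g :* q) :* p))) :* zʲ))))) refl (δ) (γ) (q) (pow q (t N.+ t N.+ 0)) (Z₀ (dec j) (dec l)) (β) (α) (cst t) (Z₀ (dec j) l) (Z₀ j (dec (dec l))) (Z₀ j (dec l)))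
      (sym (+-cong (*-congˡ (V₀ j (dec l))) (*-congˡ (U′₀ j l)))))

    -- Induction steps: expand level k+1 by the recursions of U, V, U′, V′;
    -- adding multiples of Rel₁ and Rel₂ at level k (at (j,ℓ) and its shifts)
    -- to both sides turns the claim into a polynomial identity.
    Rel₁-step : ∀ k → (∀ j l → Rel₁ k j l) → (∀ j l → Rel₂ k j l) → ∀ j l → Rel₁ (suc k) j l
    Rel₁-step k rel₁ rel₂ j l = cancel
      (trans (+-congʳ (+-cong (U-rec t k j l) (*-congˡ (V-rec t k j l)))) (trans
        (solve 15 (λ d q uʲ vʲ b u uˡ v vˡ u′ v′ u′ʲ v′ʲ u′ˡ v′ˡ → ((((d :* ((q :* q) :* (uʲ :+ vʲ))) :+ (((b :* u) :+ ((d :* q) :* uʲ)) :+ (q :* uˡ))) :+ (q :* ((b :* (u :+ v)) :+ (q :* (((b :* v) :+ ((d :* q) :* vʲ)) :+ (q :* vˡ)))))) :+ (((((((b :+ (q :* b)) :* ((q :* u′) :+ v′)) :+ (((d :* q) :* q) :* ((q :* u′ʲ) :+ v′ʲ))) :+ ((d :* q) :* ((q :* u′ʲ) :+ v′ʲ))) :+ (q :* ((q :* u′ˡ) :+ v′ˡ))) :+ ((q :* q) :* ((d :* v′ʲ) :+ v′ˡ))) :+ (q :* ((q :* vˡ) :+ (b :* u′))))) := (((q :* (((b :* u′) :+ ((d :* q) :* (q :* u′ʲ))) :+ (q :* ((d :* (u′ʲ :+ v′ʲ)) :+ u′ˡ)))) :+ (((b :* v′) :+ ((d :* q) :* (q :*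 v′ʲ))) :+ (q :* ((b :* (u′ :+ v′)) :+ (q :* v′ˡ))))) :+ (((((((b :+ (q :* b)) :* (u :+ (q :* v))) :+ (((d :* q) :* q) :* (uʲ :+ (q :* vʲ)))) :+ ((d :* q) :* (uʲ :+ (q :* vʲ)))) :+ (q :* (uˡ :+ (q :* vˡ)))) :+ ((q :* q) :* ((q :* vˡ) :+ (b :* u′)))) :+ (q :* ((d :* v′ʲ) :+ v′ˡ))))) refl (δ) (q) (U t k (dec j) l) (V t k (dec j) l) (β) (U t k j l) (U t k j (dec l)) (V t k j l) (V t k j (dec l)) (U′ t k j l) (V′ t k j l) (U′ t k (dec j) l) (V′ t k (dec j) l) (U′ t k j (dec l)) (V′ t k j (dec l)))
        (sym (+-congʳ (+-cong (*-congˡ (U′-rec t k j l)) (V′-rec t k j l))))))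
      (+-cong (+-cong (+-cong (+-cong (+-cong (*-congˡ (sym (rel₁ j l))) (*-congˡ (sym (rel₁ (dec j) l)))) (*-congˡ (sym (rel₁ (dec j) l)))) (*-congˡ (sym (rel₁ j (dec l))))) (*-congˡ (rel₂ j l))) (*-congˡ (sym (rel₂ j l))))

    Rel₂-step : ∀ k → (∀ j l → Rel₁ k j l) → (∀ j l → Rel₂ k j l) → ∀ j l → Rel₂ (suc k) j l
    Rel₂-step k rel₁ rel₂ j l = cancel
      (trans (+-congʳ (+-cong (*-congˡ (V′-rec t k (dec j) l)) (V′-rec t k j (dec l)))) (trans
        (solve 15 (λ d b v′ʲ q v′ʲʲ u′ʲ v′ʲˡ v′ˡ u′ˡ v′ˡˡ uˡ vˡ u′ vʲˡ vˡˡ → (((d :* (((b :* v′ʲ) :+ ((d :* q) :* (q :* v′ʲʲ))) :+ (q :* ((b :* (u′ʲ :+ v′ʲ)) :+ (q :* v′ʲˡ))))) :+ (((b :* v′ˡ) :+ ((d :* q) :* (q :* v′ʲˡ))) :+ (q :* ((b :* (u′ˡ :+ v′ˡ)) :+ (q :* v′ˡˡ))))) :+ (((b :* q) :* (uˡ :+ (q :* vˡ))) :+ (((b :* ((q :* vˡ) :+ (b :* u′))) :+ (((d :* q) :* q) :* ((q :* vʲˡ) :+ (b :* u′ʲ)))) :+ ((q :* q) :* ((q :* vˡˡ) :+ (b :* u′ˡ)))))) := (((q :* ((b :* (uˡ :+ vˡ)) :+ (q :* (((b :* vˡ) :+ ((d :* q) :* vʲˡ)) :+ (q :* vˡˡ)))))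 :+ (b :* (((b :* u′) :+ ((d :* q) :* (q :* u′ʲ))) :+ (q :* ((d :* (u′ʲ :+ v′ʲ)) :+ u′ˡ))))) :+ (((b :* q) :* ((q :* u′ˡ) :+ v′ˡ)) :+ (((b :* ((d :* v′ʲ) :+ v′ˡ)) :+ (((d :* q) :* q) :* ((d :* v′ʲʲ) :+ v′ʲˡ))) :+ ((q :* q) :* ((d :* v′ʲˡ) :+ v′ˡˡ)))))) refl (δ) (β) (V′ t k (dec j) l) (q) (V′ t k (dec (dec j)) l) (U′ t k (dec j) l) (V′ t k (dec j) (dec l)) (V′ t k j (dec l)) (U′ t k j (dec l)) (V′ t k j (dec (dec l))) (U t k j (dec l)) (V t k j (dec l)) (U′ t k j l) (V t k (dec j) (dec l)) (V t k j (dec (dec l))))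
        (sym (+-congʳ (+-cong (*-congˡ (V-rec t k j (dec l))) (*-congˡ (U′-rec t k j l)))))))
      (+-cong (*-congˡ (rel₁ j (dec l))) (+-cong (+-cong (*-congˡ (sym (rel₂ j l))) (*-congˡ (sym (rel₂ (dec j) l)))) (*-congˡ (sym (rel₂ j (dec l))))))

    relations : ∀ k → (∀ j l → Rel₁ k j l) × (∀ j l → Rel₂ k j l)
    relations zero = Rel₁-base , Rel₂-base
    relations (suc k) = Rel₁-step k (proj₁ (relations k)) (proj₂ (relations k)) , Rel₂-step k (proj₁ (relations k)) (proj₂ (relations k))

  first-identity : ∀ t j k l → prod0 (D t) A j k l - q * prod0 A (D (suc t)) j k l ≈ prod0 A (E (suc t)) j k l - q * prod0 (E t) A j k l
  first-identity t j k l = begin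
    prod0 (D t) A j k l - q * prod0 A (D (suc t)) j k l ≈⟨ +-cong (DA≈U t j k l) (-‿cong (*-congˡ (AD≈U′ t j k l))) ⟩
    U t k (+ j) (+ l) - q * U′ t k (+ j) (+ l)         ≈⟨ swap-sides q (proj₁ (relations t k) (+ j) (+ l)) ⟩
    V′ t k (+ j) (+ l) - q * V t k (+ j) (+ l)         ≈⟨ sym (+-cong (AE≈V′ t j k l) (-‿cong (*-congˡ (EA≈V t j k l)))) ⟩
    prod0 A (E (suc t)) j k l - q * prod0 (E t) A j k l ∎

-- The weight and admissibility of a tile only depend on the letter
-- it sees below, so the generating function of the fillings of the tiles
-- above a given tile (Fill) satisfies a recursion over the strip list; the
-- F^(t) condition "the first letter above the bottom δ is a β in a square"
-- gives a second recursion (Firstβ) with F^(t) = δ · Firstβ.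
module Columns {c ℓ′} (R : CommutativeRing c ℓ′) (α β γ δ q : CommutativeRing.Carrier R) where
  open CommutativeRing R hiding (zero)
  open Matrices R α β γ δ q hiding (Σ<)
  open Arrays R
  open import Relation.Binary.Reasoning.Setoid setoid
  open import Algebra.Solver.Ring.NaturalCoefficients.Default commutativeSemiring

  SumL : ∀ {A : Set} → List A → (A → Carrier) → Carrier
  SumL L f = sumL (map f L)

  SumL-cong : ∀ {A : Set} (L : List A) {f g : A → Carrier} → (∀ x → f x ≈ g x) → SumL L f ≈ SumL L g
  SumL-cong [] e = refl
  SumL-cong (x ∷ L) e = +-cong (e x) (SumL-cong L e)

  SumL-zero : ∀ {A : Set} (L : List A) (f : A → Carrier) → (∀ x → f x ≈ 0#) → SumL L f ≈ 0#
  SumL-zero [] f e = refl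
  SumL-zero (x ∷ L) f e = trans (+-cong (e x) (SumL-zero L f e)) (+-identityʳ 0#)

  SumL-* : ∀ {A : Set} (L : List A) (y : Carrier) (f : A → Carrier) → SumL L (λ x → y * f x) ≈ y * SumL L f
  SumL-* [] y f = sym (zeroʳ y)
  SumL-* (x ∷ L) y f = trans (+-congˡ (SumL-* L y f)) (sym (distribˡ y _ _))

  sumL-++ : ∀ (xs ys : List Carrier) → sumL (xs ++ ys) ≈ sumL xs + sumL ys
  sumL-++ [] ys = sym (+-identityˡ _)
  sumL-++ (x ∷ xs) ys = trans (+-congˡ (sumL-++ xs ys)) (sym (+-assoc _ _ _))

  sumL-concatMap : ∀ {A : Set} (g : A → List Carrier) (L : List A) → sumL (concatMap g L) ≈ SumL L (λ x → sumL (g x))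
  sumL-concatMap g [] = refl
  sumL-concatMap g (x ∷ L) = trans (sumL-++ (g x) (concatMap g L)) (+-congˡ (sumL-concatMap g L))

  SumL-++ : ∀ {A : Set} (xs ys : List A) f → SumL (xs ++ ys) f ≈ SumL xs f + SumL ys f
  SumL-++ [] ys f = sym (+-identityˡ _)
  SumL-++ (x ∷ xs) ys f = trans (+-congˡ (SumL-++ xs ys f)) (sym (+-assoc _ _ _))

  SumL-concatMap : ∀ {A B : Set} (g : A → List B) (L : List A) f → SumL (concatMap g L) f ≈ SumL L (λ x → SumL (g x) f)
  SumL-concatMap g [] f = refl
  SumL-concatMap g (x ∷ L) f = trans (SumL-++ (g x) (concatMap g L) f) (+-congˡ (SumL-concatMap g L f))

  SumL-map : ∀ {A B : Set} (h : A → B) (L : List A) f → SumL (map h L) f ≈ SumL L (λ x → f (h x))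
  SumL-map h [] f = refl
  SumL-map h (x ∷ L) f = +-congˡ (SumL-map h L f)

  allFillings-split : ∀ n (f : List (Maybe Letter) → Carrier) → SumL (allFillings (suc n)) f ≈ SumL contents (λ x → SumL (allFillings n) (λ xs → f (x ∷ xs)))
  allFillings-split n f = trans (SumL-concatMap (λ x → map (x ∷_) (allFillings n)) contents f)
    (SumL-cong contents (λ x → SumL-map (x ∷_) (allFillings n) f))

  ind : Bool → Carrier
  ind true = 1#
  ind false = 0#

  ind-if : ∀ b (x : Carrier) → (if b then x else 0#) ≈ ind b * x
  ind-if true x = sym (*-identityˡ x)
  ind-if false x = sym (zeroˡ x)

  ind-∧ : ∀ b b′ → ind (b ∧ b′) ≈ ind b * ind b′
  ind-∧ true b′ = sym (*-identityˡ _)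
  ind-∧ false b′ = sym (zeroˡ _)

  column-ok : Letter → List Tile → Bool
  column-ok l cs = allB (zipWith tileOK cs (seenBelow l cs))
  column-weight : Letter → List Tile → Carrier
  column-weight l cs = prodL (zipWith tileW cs (seenBelow l cs))

  next-seen : Letter → Maybe Letter → Letter
  next-seen l nothing = l
  next-seen l (just m) = m

  column-ok-sq : ∀ l τ x cs → column-ok l (sq τ x ∷ cs) P.≡ (tileOK (sq τ x) l ∧ column-ok (next-seen l x) cs)
  column-ok-sq l τ nothing cs = P.refl
  column-ok-sq l τ (just m) cs = P.refl
  column-weight-sq : ∀ l τ x cs → column-weight l (sq τ x ∷ cs) P.≡ tileW (sq τ x) l * column-weight (next-seen l x) cs
  column-weight-sq l τ nothing cs = P.refl
  column-weight-sq l τ (just m) cs = P.refl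
  column-ok-rh : ∀ l y cs → column-ok l (rh y ∷ cs) P.≡ (tileOK (rh y) l ∧ column-ok (next-seen l y) cs)
  column-ok-rh l nothing cs = P.refl
  column-ok-rh l (just m) cs = P.refl
  column-weight-rh : ∀ l y cs → column-weight l (rh y ∷ cs) P.≡ tileW (rh y) l * column-weight (next-seen l y) cs
  column-weight-rh l nothing cs = P.refl
  column-weight-rh l (just m) cs = P.refl

  -- How the indices (number of δ-strips, number of α/γ-strips) of the new
  -- tableau change with the content of a square: a δ-strip, or an α/γ-strip
  -- receiving δ, raises the first; an α/γ-strip keeping its type raises the
  -- second; otherwise nothing changes.
  data Move : Set where
    stay up₁ up₂ : Move

  move : Move → NArray → NArray
  move stay S = S
  move up₁ S = shift₁ S
  move up₂ S = shift₂ S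

  strip-move : StripType → Maybe Letter → Move
  strip-move sβ x = stay
  strip-move sδ x = up₁
  strip-move sαγ (just Lδ) = up₁
  strip-move sαγ (just Lβ) = stay
  strip-move sαγ (just Lα) = up₂
  strip-move sαγ (just Lγ) = up₂
  strip-move sαγ nothing = up₂

  target : List StripType → List (Maybe Letter) → NArray
  target ts xs a b = ind (newδ ts xs ≡ᵇ a) * ind (newαγ ts xs ≡ᵇ b)

  target-cons : ∀ τ x ts xs a b → target (τ ∷ ts) (x ∷ xs) a b ≈ move (strip-move τ x) (target ts xs) a b
  target-cons sδ x ts xs zero b = zeroˡ _
  target-cons sδ x ts xs (suc a) b = refl
  target-cons sαγ (just Lδ) ts xs zero b = zeroˡ _
  target-cons sαγ (just Lδ) ts xs (suc a) b = refl
  target-cons sαγ (just Lβ) ts xs a b = refl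
  target-cons sαγ nothing ts xs a zero = zeroʳ _
  target-cons sαγ nothing ts xs a (suc b) = refl
  target-cons sαγ (just Lα) ts xs a zero = zeroʳ _
  target-cons sαγ (just Lα) ts xs a (suc b) = refl
  target-cons sαγ (just Lγ) ts xs a zero = zeroʳ _
  target-cons sαγ (just Lγ) ts xs a (suc b) = refl
  target-cons sβ x ts xs a b = refl

  move-* : ∀ m (y : Carrier) S a b → move m (λ a b → y * S a b) a b ≈ y * move m S a b
  move-* stay y S a b = refl
  move-* up₁ y S zero b = sym (zeroʳ y)
  move-* up₁ y S (suc a) b = refl
  move-* up₂ y S a zero = sym (zeroʳ y)
  move-* up₂ y S a (suc b) = refl

  move-SumL : ∀ {A : Set} m (L : List A) (g : A → NArray) a b → SumL L (λ z → move m (g z) a b) ≈ move m (λ a b → SumL L (λ z → g z a b)) a b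
  move-SumL stay L g a b = refl
  move-SumL up₁ L g zero b = SumL-zero L _ (λ _ → refl)
  move-SumL up₁ L g (suc a) b = refl
  move-SumL up₂ L g a zero = SumL-zero L _ (λ _ → refl)
  move-SumL up₂ L g a (suc b) = refl

  move-cong : ∀ m {S T : NArray} → (∀ a b → S a b ≈ T a b) → ∀ a b → move m S a b ≈ move m T a b
  move-cong stay e a b = e a b
  move-cong up₁ e zero b = refl
  move-cong up₁ e (suc a) b = e a b
  move-cong up₂ e a zero = refl
  move-cong up₂ e a (suc b) = e a b

  SumL-*ʳ : ∀ {A : Set} (L : List A) (y : Carrier) (f : A → Carrier) → SumL L (λ x → f x * y) ≈ SumL L f * y
  SumL-*ʳ L y f = trans (SumL-cong L (λ x → *-comm (f x) y)) (trans (SumL-* L y f) (*-comm y _))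

  firstIsβSquare-rhombi : ∀ ys → firstIsβSquare (map rh ys) P.≡ false
  firstIsβSquare-rhombi [] = P.refl
  firstIsβSquare-rhombi (nothing ∷ ys) = firstIsβSquare-rhombi ys
  firstIsβSquare-rhombi (just x ∷ ys) = P.refl

  RhombiFill : ℕ → Letter → Carrier
  RhombiFill t′ l = SumL (allFillings t′) (λ ys → ind (column-ok l (map rh ys)) * column-weight l (map rh ys))

  RhombiFill-suc : ∀ t′ l → RhombiFill (suc t′) l ≈ SumL contents (λ y → ind (tileOK (rh y) l) * tileW (rh y) l * RhombiFill t′ (next-seen l y))
  RhombiFill-suc t′ l = trans (allFillings-split t′ _) (SumL-cong contents (λ y →
    trans (SumL-cong (allFillings t′) (λ ys → trans (*-cong (reflexive (P.cong ind (column-ok-rh l y (map rh ys)))) (reflexive (column-weight-rh l y (map rh ys))))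
      (trans (*-congʳ (ind-∧ (tileOK (rh y) l) (column-ok (next-seen l y) (map rh ys)))) (solve 4 (λ iT iO w W → iT :* iO :* (w :* W) := iT :* w :* (iO :* W)) refl _ _ _ _))))
    (SumL-* (allFillings t′) _ _)))

  module _ (t : ℕ) where
    term : Letter → List StripType → List (Maybe Letter) → List (Maybe Letter) → NArray
    term l ts xs ys a b = ind (column-ok l (column ts xs ys)) * column-weight l (column ts xs ys) * target ts xs a b

    FillSum : Letter → List StripType → NArray
    FillSum l ts a b = SumL (allFillings (length ts)) (λ xs → SumL (allFillings t) (λ ys → term l ts xs ys a b))

    Fill : Letter → List StripType → NArray
    Fill l [] a b = RhombiFill t l * target [] [] a b
    Fill l (τ ∷ ts) a b = SumL contents (λ x → ind (tileOK (sq τ x) l) * tileW (sq τ x) l * move (strip-move τ x) (Fill (next-seen l x) ts) a b)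

    term-cons : ∀ l τ x ts xs ys a b → term l (τ ∷ ts) (x ∷ xs) ys a b ≈ ind (tileOK (sq τ x) l) * tileW (sq τ x) l * move (strip-move τ x) (term (next-seen l x) ts xs ys) a b
    term-cons l τ x ts xs ys a b = begin
      ind (column-ok l (sq τ x ∷ col)) * column-weight l (sq τ x ∷ col) * target (τ ∷ ts) (x ∷ xs) a b
        ≈⟨ *-cong (*-cong (reflexive (P.cong ind (column-ok-sq l τ x col))) (reflexive (column-weight-sq l τ x col))) (target-cons τ x ts xs a b) ⟩
      ind (tileOK (sq τ x) l ∧ column-ok (next-seen l x) col) * (tileW (sq τ x) l * column-weight (next-seen l x) col) * move (strip-move τ x) (target ts xs) a b
        ≈⟨ *-congʳ (*-congʳ (ind-∧ (tileOK (sq τ x) l) (column-ok (next-seen l x) col))) ⟩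
      ind (tileOK (sq τ x) l) * ind (column-ok (next-seen l x) col) * (tileW (sq τ x) l * column-weight (next-seen l x) col) * move (strip-move τ x) (target ts xs) a b
        ≈⟨ solve 5 (λ iT iO w W s → iT :* iO :* (w :* W) :* s := iT :* w :* (iO :* W :* s)) refl _ _ _ _ _ ⟩
      ind (tileOK (sq τ x) l) * tileW (sq τ x) l * (ind (column-ok (next-seen l x) col) * column-weight (next-seen l x) col * move (strip-move τ x) (target ts xs) a b)
        ≈⟨ *-congˡ (sym (move-* (strip-move τ x) (ind (column-ok (next-seen l x) col) * column-weight (next-seen l x) col) (target ts xs) a b)) ⟩
      ind (tileOK (sq τ x) l) * tileW (sq τ x) l * move (strip-move τ x) (term (next-seen l x) ts xs ys) a b ∎
      where col = column ts xs ys

    FillSum≈Fill : ∀ l ts a b → FillSum l ts a b ≈ Fill l ts a b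
    FillSum≈Fill l [] a b = trans (+-identityʳ _) (SumL-*ʳ (allFillings t) (target [] [] a b) _)
    FillSum≈Fill l (τ ∷ ts) a b = trans (allFillings-split (length ts) _) (SumL-cong contents (λ x → begin
      SumL (allFillings (length ts)) (λ xs → SumL (allFillings t) (λ ys → term l (τ ∷ ts) (x ∷ xs) ys a b))
        ≈⟨ SumL-cong (allFillings (length ts)) (λ xs → SumL-cong (allFillings t) (λ ys → term-cons l τ x ts xs ys a b)) ⟩
      SumL (allFillings (length ts)) (λ xs → SumL (allFillings t) (λ ys → C x * move (strip-move τ x) (term (next-seen l x) ts xs ys) a b))
        ≈⟨ SumL-cong (allFillings (length ts)) (λ xs → trans (SumL-* (allFillings t) (C x) _) (*-congˡ (move-SumL (strip-move τ x) (allFillings t) _ a b))) ⟩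
      SumL (allFillings (length ts)) (λ xs → C x * move (strip-move τ x) (λ a b → SumL (allFillings t) (λ ys → term (next-seen l x) ts xs ys a b)) a b)
        ≈⟨ trans (SumL-* (allFillings (length ts)) (C x) _) (*-congˡ (move-SumL (strip-move τ x) (allFillings (length ts)) _ a b)) ⟩
      C x * move (strip-move τ x) (FillSum (next-seen l x) ts) a b
        ≈⟨ *-congˡ (move-cong (strip-move τ x) (FillSum≈Fill (next-seen l x) ts) a b) ⟩
      C x * move (strip-move τ x) (Fill (next-seen l x) ts) a b ∎))
      where
      C : Maybe Letter → Carrier
      C x = ind (tileOK (sq τ x) l) * tileW (sq τ x) l

    -- the fillings above the bottom δ in which the first letter is a β in a
    -- square: empty squares are skipped, then a β-square is followed by any
    -- filling
    firstβ-step : StripType → Maybe Letter → NArray → NArray → NArray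
    firstβ-step τ nothing P Q a b = ind (tileOK (sq τ nothing) Lδ) * tileW (sq τ nothing) Lδ * move (strip-move τ nothing) P a b
    firstβ-step τ (just Lβ) P Q a b = ind (tileOK (sq τ (just Lβ)) Lδ) * tileW (sq τ (just Lβ)) Lδ * move (strip-move τ (just Lβ)) Q a b
    firstβ-step τ (just Lα) P Q a b = 0#
    firstβ-step τ (just Lγ) P Q a b = 0#
    firstβ-step τ (just Lδ) P Q a b = 0#

    Firstβ : List StripType → NArray
    Firstβ [] a b = 0#
    Firstβ (τ ∷ ts) a b = SumL contents (λ x → firstβ-step τ x (Firstβ ts) (Fill Lβ ts) a b)

    FirstβSum : List StripType → NArray
    FirstβSum ts a b = SumL (allFillings (length ts)) (λ xs → SumL (allFillings t) (λ ys → ind (firstIsβSquare (column ts xs ys)) * term Lδ ts xs ys a b))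

    pull : ∀ τ x (y : Carrier) (n : ℕ) (g : List (Maybe Letter) → List (Maybe Letter) → NArray) a b →
      SumL (allFillings n) (λ xs → SumL (allFillings t) (λ ys → y * move (strip-move τ x) (g xs ys) a b))
        ≈ y * move (strip-move τ x) (λ a b → SumL (allFillings n) (λ xs → SumL (allFillings t) (λ ys → g xs ys a b))) a b
    pull τ x y n g a b = trans (SumL-cong (allFillings n) (λ xs → trans (SumL-* (allFillings t) y _) (*-congˡ (move-SumL (strip-move τ x) (allFillings t) _ a b))))
      (trans (SumL-* (allFillings n) y _) (*-congˡ (move-SumL (strip-move τ x) (allFillings n) _ a b)))

    swap-factor : ∀ (i c s : Carrier) → i * (c * s) ≈ c * (i * s)
    swap-factor i c s = solve 3 (λ i c s → i :* (c :* s) := c :* (i :* s)) refl i c s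

    FirstβSum≈Firstβ : ∀ ts a b → FirstβSum ts a b ≈ Firstβ ts a b
    FirstβSum≈Firstβ [] a b = trans (+-identityʳ _) (SumL-zero (allFillings t) _ (λ ys → trans (*-congʳ (reflexive (P.cong ind (firstIsβSquare-rhombi ys)))) (zeroˡ _)))
    FirstβSum≈Firstβ (τ ∷ ts) a b = trans (allFillings-split (length ts) _) (SumL-cong contents by-lowest-square)
      where
      n : ℕ
      n = length ts
      by-lowest-square : ∀ x → SumL (allFillings n) (λ xs → SumL (allFillings t) (λ ys → ind (firstIsβSquare (column (τ ∷ ts) (x ∷ xs) ys)) * term Lδ (τ ∷ ts) (x ∷ xs) ys a b))
                  ≈ firstβ-step τ x (Firstβ ts) (Fill Lβ ts) a b
      by-lowest-square nothing = trans (SumL-cong (allFillings n) (λ xs → SumL-cong (allFillings t) (λ ys →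
          trans (*-congˡ (term-cons Lδ τ nothing ts xs ys a b)) (trans (swap-factor _ _ _) (*-congˡ (sym (move-* (strip-move τ nothing) _ (term Lδ ts xs ys) a b)))))))
        (trans (pull τ nothing _ n (λ xs ys a b → ind (firstIsβSquare (column ts xs ys)) * term Lδ ts xs ys a b) a b)
          (*-congˡ (move-cong (strip-move τ nothing) (FirstβSum≈Firstβ ts) a b)))
      by-lowest-square (just Lβ) = trans (SumL-cong (allFillings n) (λ xs → SumL-cong (allFillings t) (λ ys →
          trans (*-identityˡ _) (term-cons Lδ τ (just Lβ) ts xs ys a b))))
        (trans (pull τ (just Lβ) _ n (λ xs ys → term Lβ ts xs ys) a b)
          (*-congˡ (move-cong (strip-move τ (just Lβ)) (FillSum≈Fill Lβ ts) a b)))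
      by-lowest-square (just Lα) = SumL-zero (allFillings n) _ (λ xs → SumL-zero (allFillings t) _ (λ ys → zeroˡ _))
      by-lowest-square (just Lγ) = SumL-zero (allFillings n) _ (λ xs → SumL-zero (allFillings t) _ (λ ys → zeroˡ _))
      by-lowest-square (just Lδ) = SumL-zero (allFillings n) _ (λ xs → SumL-zero (allFillings t) _ (λ ys → zeroˡ _))

    summand : List StripType → List (Maybe Letter) → List (Maybe Letter) → NArray
    summand ts xs ys a b = if validCol ts xs ys ∧ (newδ ts xs ≡ᵇ a) ∧ (newαγ ts xs ≡ᵇ b) then colW (column ts xs ys) else 0#

    F≈Firstβ : ∀ ts a b → F t ts a b ≈ δ * Firstβ ts a b
    F≈Firstβ [] a b = trans (sumL-concatMap (λ xs → map (λ ys → summand [] xs ys a b) (allFillings t)) (allFillings 0))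
      (trans (+-identityʳ _) (trans (SumL-zero (allFillings t) _ (λ ys → refl)) (sym (zeroʳ δ))))
    F≈Firstβ (τ ∷ ts) a b = trans (sumL-concatMap (λ xs → map (λ ys → summand (τ ∷ ts) xs ys a b) (allFillings t)) (allFillings (suc (length ts))))
      (trans (SumL-cong (allFillings (suc (length ts))) (λ xs → SumL-cong (allFillings t) (λ ys → summand-factored xs ys)))
      (trans (SumL-cong (allFillings (suc (length ts))) (λ xs → SumL-* (allFillings t) δ _))
      (trans (SumL-* (allFillings (suc (length ts))) δ _) (*-congˡ (FirstβSum≈Firstβ (τ ∷ ts) a b)))))
      where
      summand-factored : ∀ xs ys → (if validCol (τ ∷ ts) xs ys ∧ (newδ (τ ∷ ts) xs ≡ᵇ a) ∧ (newαγ (τ ∷ ts) xs ≡ᵇ b) then colW (column (τ ∷ ts) xs ys) else 0#)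
                      ≈ δ * (ind (firstIsβSquare (column (τ ∷ ts) xs ys)) * term Lδ (τ ∷ ts) xs ys a b)
      summand-factored xs ys = trans (ind-if _ _) (trans (*-congʳ (trans (ind-∧ (fβ ∧ ok) (nd ∧ na)) (*-cong (ind-∧ fβ ok) (ind-∧ nd na))))
        (solve 6 (λ f o n m d w → f :* o :* (n :* m) :* (d :* w) := d :* (f :* (o :* w :* (n :* m)))) refl _ _ _ _ δ _))
        where
        fβ ok nd na : Bool
        fβ = firstIsβSquare (column (τ ∷ ts) xs ys)
        ok = column-ok Lδ (column (τ ∷ ts) xs ys)
        nd = newδ (τ ∷ ts) xs ≡ᵇ a
        na = newαγ (τ ∷ ts) xs ≡ᵇ b

module ColumnSteps {c ℓ′} (R : CommutativeRing c ℓ′) (α β γ δ q : CommutativeRing.Carrier R) (t : ℕ) where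
  open CommutativeRing R hiding (zero)
  open Matrices R α β γ δ q hiding (Σ<)
  open Arrays R
  open Powers R α β γ δ q
  open Columns R α β γ δ q
  open import Algebra.Solver.Ring.NaturalCoefficients.Default commutativeSemiring

  -- a square of a β-strip lies left of a β, hence is empty and of weight 1
  Fill-β-strip : ∀ l ts a b → Fill t l (sβ ∷ ts) a b ≈ Fill t l ts a b
  Fill-β-strip l ts a b = solve 9 (λ P P1 P2 P3 P4 w1 w2 w3 w4 → con 1 :* con 1 :* P :+ (con 0 :* w1 :* P1 :+ (con 0 :* w2 :* P2 :+ (con 0 :* w3 :* P3 :+ (con 0 :* w4 :* P4 :+ con 0)))) := P) refl _ _ _ _ _ _ _ _ _

  Firstβ-β-strip : ∀ ts a b → Firstβ t (sβ ∷ ts) a b ≈ Firstβ t ts a b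
  Firstβ-β-strip ts a b = solve 3 (λ P Q w → con 1 :* con 1 :* P :+ (con 0 :+ (con 0 :* w :* Q :+ (con 0 :+ (con 0 :+ con 0)))) := P) refl _ _ _

  -- a square of an α/γ-strip seeing δ below: empty (weight 1), or the β
  Firstβ-αγ-strip : ∀ ts a b → Firstβ t (sαγ ∷ ts) a b ≈ shift₂ (Firstβ t ts) a b + β * Fill t Lβ ts a b
  Firstβ-αγ-strip ts a b = solve 3 (λ P Q w → con 1 :* con 1 :* P :+ (con 0 :+ (con 1 :* w :* Q :+ (con 0 :+ (con 0 :+ con 0)))) := P :+ w :* Q) refl _ _ _

  -- a square of an α/γ-strip above an α or γ is empty; above a β or δ it
  -- may contain any letter
  Fill-α-αγ-strip : ∀ ts a b → Fill t Lα (sαγ ∷ ts) a b ≈ shift₂ (Fill t Lα ts) a b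
  Fill-α-αγ-strip ts a b = solve 9 (λ P P1 P2 P3 P4 w1 w2 w3 w4 → con 1 :* con 1 :* P :+ (con 0 :* w1 :* P1 :+ (con 0 :* w2 :* P2 :+ (con 0 :* w3 :* P3 :+ (con 0 :* w4 :* P4 :+ con 0)))) := P) refl _ _ _ _ _ _ _ _ _

  Fill-γ-αγ-strip : ∀ ts a b → Fill t Lγ (sαγ ∷ ts) a b ≈ q * shift₂ (Fill t Lγ ts) a b
  Fill-γ-αγ-strip ts a b = solve 10 (λ q P P1 P2 P3 P4 w1 w2 w3 w4 → con 1 :* q :* P :+ (con 0 :* w1 :* P1 :+ (con 0 :* w2 :* P2 :+ (con 0 :* w3 :* P3 :+ (con 0 :* w4 :* P4 :+ con 0)))) := q :* P) refl q _ _ _ _ _ _ _ _ _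

  Fill-δ-αγ-strip : ∀ ts a b → Fill t Lδ (sαγ ∷ ts) a b ≈ shift₂ (Fill t Lδ ts) a b + (α * shift₂ (Fill t Lα ts) a b + (β * Fill t Lβ ts a b + (γ * shift₂ (Fill t Lγ ts) a b + δ * shift₁ (Fill t Lδ ts) a b)))
  Fill-δ-αγ-strip ts a b = solve 9 (λ P P1 P2 P3 P4 w1 w2 w3 w4 → con 1 :* con 1 :* P :+ (con 1 :* w1 :* P1 :+ (con 1 :* w2 :* P2 :+ (con 1 :* w3 :* P3 :+ (con 1 :* w4 :* P4 :+ con 0)))) := P :+ (w1 :* P1 :+ (w2 :* P2 :+ (w3 :* P3 :+ w4 :* P4)))) refl _ _ _ _ _ _ _ _ _

  Fill-β-αγ-strip : ∀ ts a b → Fill t Lβ (sαγ ∷ ts) a b ≈ q * shift₂ (Fill t Lβ ts) a b + (α * shift₂ (Fill t Lα ts) a b + (β * Fill t Lβ ts a b + (γ * shift₂ (Fill t Lγ ts) a b + δ * shift₁ (Fill t Lδ ts) a b)))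
  Fill-β-αγ-strip ts a b = solve 10 (λ q P P1 P2 P3 P4 w1 w2 w3 w4 → con 1 :* q :* P :+ (con 1 :* w1 :* P1 :+ (con 1 :* w2 :* P2 :+ (con 1 :* w3 :* P3 :+ (con 1 :* w4 :* P4 :+ con 0)))) := q :* P :+ (w1 :* P1 :+ (w2 :* P2 :+ (w3 :* P3 :+ w4 :* P4)))) refl q _ _ _ _ _ _ _ _ _

  -- the t′ rhombi above a tile: above α they are empty (weight u² = 1),
  -- above γ empty of weight q² each, above β or δ they contribute
  -- q^t′ + (α + γq^t′)[t′]_q
  RhombiFill-α : ∀ t′ → RhombiFill t′ Lα ≈ 1#
  RhombiFill-α zero = solve 0 (con 1 :* con 1 :+ con 0 := con 1) refl
  RhombiFill-α (suc t′) = trans (RhombiFill-suc t′ Lα)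
    (trans (solve 7 (λ a g q Ra Rb Rg Rd → con 1 :* con 1 :* Ra :+ (con 0 :* a :* Ra :+ (con 0 :* con 0 :* Rb :+ (con 0 :* (g :* q) :* Rg :+ (con 0 :* con 0 :* Rd :+ con 0)))) := Ra)
                   refl α γ q _ _ _ _)
           (RhombiFill-α t′))

  RhombiFill-γ : ∀ t′ → RhombiFill t′ Lγ ≈ pow q (t′ N.+ t′ N.+ 0)
  RhombiFill-γ zero = solve 0 (con 1 :* con 1 :+ con 0 := con 1) refl
  RhombiFill-γ (suc t′) = trans (RhombiFill-suc t′ Lγ)
    (trans (solve 7 (λ a g q Ra Rb Rg Rd → con 1 :* (q :* q) :* Rg :+ (con 0 :* a :* Ra :+ (con 0 :* con 0 :* Rb :+ (con 0 :* (g :* q) :* Rg :+ (con 0 :* con 0 :* Rd :+ con 0)))) := q :* q :* Rg)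
                   refl α γ q _ _ _ _)
           (trans (*-congˡ (RhombiFill-γ t′)) (sym (pow-2t-suc t′))))

  RhombiFill-δ : ∀ t′ → RhombiFill t′ Lδ ≈ cst t′
  RhombiFill-δ zero = solve 2 (λ a g → con 1 :* con 1 :+ con 0 := con 1 :+ (a :+ g :* con 1) :* con 0) refl α γ
  RhombiFill-δ (suc t′) = trans (RhombiFill-suc t′ Lδ)
    (trans (solve 7 (λ a g q Ra Rb Rg Rd → con 1 :* q :* Rd :+ (con 1 :* a :* Ra :+ (con 0 :* con 0 :* Rb :+ (con 1 :* (g :* q) :* Rg :+ (con 0 :* con 0 :* Rd :+ con 0))))
                                          := a :* Ra :+ q :* Rd :+ g :* q :* Rg) refl α γ q _ _ _ _)
           (trans (+-cong (+-cong (trans (*-congˡ (RhombiFill-α t′)) (*-identityʳ α)) (*-congˡ (RhombiFill-δ t′))) (*-congˡ (RhombiFill-γ t′)))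
                  (sym (cst-rec t′))))

  RhombiFill-β : ∀ t′ → RhombiFill t′ Lβ ≈ cst t′
  RhombiFill-β zero = solve 2 (λ a g → con 1 :* con 1 :+ con 0 := con 1 :+ (a :+ g :* con 1) :* con 0) refl α γ
  RhombiFill-β (suc t′) = trans (RhombiFill-suc t′ Lβ)
    (trans (solve 7 (λ a g q Ra Rb Rg Rd → con 1 :* q :* Rb :+ (con 1 :* a :* Ra :+ (con 0 :* con 0 :* Rb :+ (con 1 :* (g :* q) :* Rg :+ (con 0 :* con 0 :* Rd :+ con 0))))
                                          := a :* Ra :+ q :* Rb :+ g :* q :* Rg) refl α γ q _ _ _ _)
           (trans (+-cong (+-cong (trans (*-congˡ (RhombiFill-α t′)) (*-identityʳ α)) (*-congˡ (RhombiFill-β t′))) (*-congˡ (RhombiFill-γ t′)))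
                  (sym (cst-rec t′))))

-- The second identity AE^(t+1) - qE^(t)A = αβA - γδq^(2t+k+2)A_{j-1} + (1-q)F^(t)A
-- in row 0, for old tableaux without δ-strips (as i = 0).  In the solver
-- calls fα, ..., fδ and r stand for FillA Lα ts, ..., FillA Lδ ts and FirstβA ts,
-- with the shift superscripts of FirstIdentity; z₁, z₂ stand for Z at level
-- k+1, k+2 and G for Γ k.
module SecondIdentity {c ℓ′} (R : CommutativeRing c ℓ′) (α β γ δ q : CommutativeRing.Carrier R) (t : ℕ) where
  open CommutativeRing R hiding (zero)
  open Matrices R α β γ δ q hiding (Σ<)
  open Sums R
  open Arrays R
  open Powers R α β γ δ q
  open Slices R α β γ δ q
  open Products R α β γ δ q
  open FirstIdentity R α β γ δ q
  open Columns R α β γ δ q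
  open ColumnSteps R α β γ δ q t
  open import Relation.Binary.Reasoning.Setoid setoid
  open import Algebra.Solver.Ring.NaturalCoefficients.Default commutativeSemiring

  #αγ : List StripType → ℕ
  #αγ = countType sαγ

  Noδ : List StripType → Set
  Noδ ts = countType sδ ts ≡ 0

  -- the weight q^(2t+k) of γ in E^(t) at level k
  Γ : ℕ → Carrier
  Γ k = pow q (t N.+ t N.+ k)

  Γ-suc : ∀ k → Γ (suc k) ≈ q * Γ k
  Γ-suc k = pow-+-suc (t N.+ t) k

  FillA : Letter → List StripType → ZArray
  FillA l ts = ΦA (#αγ ts) (Fill t l ts)

  FirstβA : List StripType → ZArray
  FirstβA ts = ΦA (#αγ ts) (Firstβ t ts)

  Fill-supported : ∀ ts → Noδ ts → (∀ l → Box (#αγ ts) (Fill t l ts)) × Box (#αγ ts) (Firstβ t ts)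
  Fill-supported [] noδ = base , (λ a b h → refl)
    where
    base : ∀ l → Box 0 (Fill t l [])
    base l zero b (inj₁ ())
    base l (suc zero) b (inj₁ (N.s≤s ()))
    base l (suc (suc a)) b (inj₁ h) = trans (*-congˡ (zeroˡ _)) (zeroʳ _)
    base l a zero (inj₂ ())
    base l a (suc zero) (inj₂ (N.s≤s ()))
    base l a (suc (suc b)) (inj₂ h) = trans (*-congˡ (zeroʳ _)) (zeroʳ _)
  Fill-supported (sβ ∷ ts) noδ = (λ l → Supported-cong (Fill-β-strip l ts) (proj₁ IH l)) , Supported-cong (Firstβ-β-strip ts) (proj₂ IH)
    where
    IH : (∀ l → Box (#αγ ts) (Fill t l ts)) × Box (#αγ ts) (Firstβ t ts)
    IH = Fill-supported ts noδ
  Fill-supported (sδ ∷ ts) ()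
  Fill-supported (sαγ ∷ ts) noδ = fill-box , Supported-cong (Firstβ-αγ-strip ts) (Supported-+ (lift₂ (proj₂ IH)) (Supported-* β (same-entries (proj₁ IH Lβ))))
    where
    k : ℕ
    k = #αγ ts
    IH : (∀ l → Box k (Fill t l ts)) × Box k (Firstβ t ts)
    IH = Fill-supported ts noδ
    lift₂ : ∀ {S} → Box k S → Box (suc k) (shift₂ S)
    lift₂ s = Supported-mono grow NP.≤-refl (Supported-shift₂ s)
    lift₁ : ∀ {S} → Box k S → Box (suc k) (shift₁ S)
    lift₁ s = Supported-mono NP.≤-refl grow (Supported-shift₁ s)
    same-entries : ∀ {S} → Box k S → Box (suc k) S
    same-entries s = Supported-mono grow grow s
    any-letter : Box (suc k) (λ a b → α * shift₂ (Fill t Lα ts) a b + (β * Fill t Lβ ts a b + (γ * shift₂ (Fill t Lγ ts) a b + δ * shift₁ (Fill t Lδ ts) a b)))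
    any-letter = Supported-+ (Supported-* α (lift₂ (proj₁ IH Lα))) (Supported-+ (Supported-* β (same-entries (proj₁ IH Lβ))) (Supported-+ (Supported-* γ (lift₂ (proj₁ IH Lγ))) (Supported-* δ (lift₁ (proj₁ IH Lδ)))))
    fill-box : ∀ l → Box (suc k) (Fill t l (sαγ ∷ ts))
    fill-box Lα = Supported-cong (Fill-α-αγ-strip ts) (lift₂ (proj₁ IH Lα))
    fill-box Lγ = Supported-cong (Fill-γ-αγ-strip ts) (Supported-* q (lift₂ (proj₁ IH Lγ)))
    fill-box Lδ = Supported-cong (Fill-δ-αγ-strip ts) (Supported-+ (lift₂ (proj₁ IH Lδ)) any-letter)
    fill-box Lβ = Supported-cong (Fill-β-αγ-strip ts) (Supported-+ (Supported-* q (lift₂ (proj₁ IH Lβ))) any-letter)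

  module _ (ts : List StripType) (noδ : Noδ ts) where
    private
      k : ℕ
      k = #αγ ts
      sP : ∀ l → Box k (Fill t l ts)
      sP = proj₁ (Fill-supported ts noδ)
      sR : Box k (Firstβ t ts)
      sR = proj₂ (Fill-supported ts noδ)
      N3 : ℕ
      N3 = size (suc k)

    FillA-α-step : ∀ j l → FillA Lα (sαγ ∷ ts) j l ≈ β * FillA Lα ts j l + δ * q * FillA Lα ts (dec j) l + q * FillA Lα ts j (dec l)
    FillA-α-step j l = trans (Φ-congS N3 N3 {RA = A-slice} (Fill-α-αγ-strip ts) j l) (ΦA-shift₂ k _ (sP Lα) j l)

    FillA-γ-step : ∀ j l → FillA Lγ (sαγ ∷ ts) j l ≈ q * (β * FillA Lγ ts j l + δ * q * FillA Lγ ts (dec j) l + q * FillA Lγ ts j (dec l))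
    FillA-γ-step j l = trans (Φ-congS N3 N3 {RA = A-slice} (Fill-γ-αγ-strip ts) j l) (trans (Φ-*S N3 N3 q (shift₂ (Fill t Lγ ts)) A-slice j l) (*-congˡ (ΦA-shift₂ k _ (sP Lγ) j l)))

    FillA-δ-step : ∀ j l → FillA Lδ (sαγ ∷ ts) j l ≈ (β * FillA Lδ ts j l + δ * q * FillA Lδ ts (dec j) l + q * FillA Lδ ts j (dec l)) + (α * (β * FillA Lα ts j l + δ * q * FillA Lα ts (dec j) l + q * FillA Lα ts j (dec l)) + (β * FillA Lβ ts j l + (γ * (β * FillA Lγ ts j l + δ * q * FillA Lγ ts (dec j) l + q * FillA Lγ ts j (dec l)) + δ * (q * q * FillA Lδ ts (dec j) l))))
    FillA-δ-step j l = trans (Φ-congS N3 N3 {RA = A-slice} (Fill-δ-αγ-strip ts) j l)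
      (trans (Φ-linear₅ N3 N3 A-slice (shift₂ (Fill t Lδ ts)) (shift₂ (Fill t Lα ts)) (Fill t Lβ ts) (shift₂ (Fill t Lγ ts)) (shift₁ (Fill t Lδ ts)) α β γ δ j l)
      (+-cong (ΦA-shift₂ k _ (sP Lδ) j l) (+-cong (*-congˡ (ΦA-shift₂ k _ (sP Lα) j l)) (+-cong (*-congˡ (ΦA-grow k _ (sP Lβ) j l))
        (+-cong (*-congˡ (ΦA-shift₂ k _ (sP Lγ) j l)) (*-congˡ (ΦA-shift₁ k _ (sP Lδ) j l)))))))

    FillA-β-step : ∀ j l → FillA Lβ (sαγ ∷ ts) j l ≈ q * (β * FillA Lβ ts j l + δ * q * FillA Lβ ts (dec j) l + q * FillA Lβ ts j (dec l)) + (α * (β * FillA Lα ts j l + δ * q * FillA Lα ts (dec j) l + q * FillA Lα ts j (dec l)) + (β * FillA Lβ ts j l + (γ * (β * FillA Lγ ts j l + δ * q * FillA Lγ ts (dec j) l + q * FillA Lγ ts j (dec l)) + δ * (q * q * FillA Lδ ts (dec j) l))))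
    FillA-β-step j l = trans (Φ-congS N3 N3 {RA = A-slice} (Fill-β-αγ-strip ts) j l)
      (trans (Φ-linear₅ N3 N3 A-slice (λ a b → q * shift₂ (Fill t Lβ ts) a b) (shift₂ (Fill t Lα ts)) (Fill t Lβ ts) (shift₂ (Fill t Lγ ts)) (shift₁ (Fill t Lδ ts)) α β γ δ j l)
      (+-cong (trans (Φ-*S N3 N3 q (shift₂ (Fill t Lβ ts)) A-slice j l) (*-congˡ (ΦA-shift₂ k _ (sP Lβ) j l))) (+-cong (*-congˡ (ΦA-shift₂ k _ (sP Lα) j l)) (+-cong (*-congˡ (ΦA-grow k _ (sP Lβ) j l))
        (+-cong (*-congˡ (ΦA-shift₂ k _ (sP Lγ) j l)) (*-congˡ (ΦA-shift₁ k _ (sP Lδ) j l)))))))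

    FirstβA-step : ∀ j l → FirstβA (sαγ ∷ ts) j l ≈ β * FirstβA ts j l + δ * q * FirstβA ts (dec j) l + q * FirstβA ts j (dec l) + β * FillA Lβ ts j l
    FirstβA-step j l = trans (Φ-congS N3 N3 {RA = A-slice} (Firstβ-αγ-strip ts) j l)
      (trans (Φ-+S N3 N3 (shift₂ (Firstβ t ts)) (λ a b → β * Fill t Lβ ts a b) A-slice j l)
        (+-cong (ΦA-shift₂ k _ sR j l) (trans (Φ-*S N3 N3 β (Fill t Lβ ts) A-slice j l) (*-congˡ (ΦA-grow k _ (sP Lβ) j l)))))

  FillA-β-strip : ∀ L ts j l → FillA L (sβ ∷ ts) j l ≈ FillA L ts j l
  FillA-β-strip L ts j l = Φ-congS (size (#αγ ts)) (size (#αγ ts)) {RA = A-slice} (Fill-β-strip L ts) j l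
  FirstβA-β-strip : ∀ ts j l → FirstβA (sβ ∷ ts) j l ≈ FirstβA ts j l
  FirstβA-β-strip ts j l = Φ-congS (size (#αγ ts)) (size (#αγ ts)) {RA = A-slice} (Firstβ-β-strip ts) j l

  -- with no strips left only the rhombi remain, and the indices are (1, 0)
  FillA-base : ∀ L j l → FillA L [] j l ≈ RhombiFill t L * (q * q * Z t 0 (dec j) l)
  FillA-base L j l = trans (solve 5 (λ r x00 x01 x10 x11 → (con 0 :+ ((con 0 :+ r :* (con 0 :* con 1) :* x00) :+ r :* (con 0 :* con 0) :* x01)) :+ ((con 0 :+ r :* (con 1 :* con 1) :* x10) :+ r :* (con 1 :* con 0) :* x11) := r :* x10) refl (RhombiFill t L) (A-slice 0 0 j l) (A-slice 0 1 j l) (A-slice 1 0 j l) (A-slice 1 1 j l))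
    (*-congˡ (A-slice-shift 0 0 j l))

  record ClosedForms (ts : List StripType) : Set (c ⊔ ℓ′) where
    field
      above-α : ∀ j l → FillA Lα ts j l ≈ q * q * Z t (#αγ ts) (dec j) l
      above-γ : ∀ j l → FillA Lγ ts j l ≈ Γ (#αγ ts) * (q * q * Z t (#αγ ts) (dec j) l)
      above-δ : ∀ j l → δ * FillA Lδ ts j l + α * Z t (suc (#αγ ts)) j l ≈ U t (#αγ ts) j l
      above-β : ∀ j l → β * FillA Lβ ts j l + γ * Γ (#αγ ts) * (q * q * Z t (suc (#αγ ts)) (dec j) l) ≈ q * q * V t (#αγ ts) (dec j) l

  closed-forms : ∀ ts → Noδ ts → ClosedForms ts
  closed-forms [] noδ = record
    { above-α = λ j l → trans (FillA-base Lα j l) (trans (*-congʳ (RhombiFill-α t)) (*-identityˡ _))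
    ; above-γ = λ j l → trans (FillA-base Lγ j l) (*-congʳ (RhombiFill-γ t))
    ; above-δ = λ j l → trans (+-cong (*-congˡ (trans (FillA-base Lδ j l) (*-congʳ (RhombiFill-δ t)))) (*-congˡ (Z-rec t 0 j l)))
                (trans (solve 8 (λ d a b q c z zx zy → d :* (c :* (q :* q :* zx)) :+ a :* (b :* z :+ d :* q :* zx :+ q :* zy) := a :* (b :* z :+ d :* q :* zx :+ q :* zy) :+ d :* c :* (q :* q :* zx)) refl δ α β q (cst t) (Z₀ j l) (Z₀ (dec j) l) (Z₀ j (dec l)))
                  (sym (U₀ t j l)))
    ; above-β = λ j l → trans (+-cong (*-congˡ (trans (FillA-base Lβ j l) (*-congʳ (RhombiFill-β t)))) (*-congˡ (*-congˡ (Z-rec t 0 (dec j) l))))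
                (trans (solve 9 (λ b g d q c P z zx zy → b :* (c :* (q :* q :* z)) :+ g :* P :* (q :* q :* (b :* z :+ d :* q :* zx :+ q :* zy)) := q :* q :* (b :* c :* z :+ g :* P :* (b :* z :+ d :* q :* zx :+ q :* zy))) refl β γ δ q (cst t) (pow q (t N.+ t N.+ 0)) (Z₀ (dec j) l) (Z₀ (dec (dec j)) l) (Z₀ (dec j) (dec l)))
                  (*-congˡ (sym (V₀ t (dec j) l))))
    }
  closed-forms (sβ ∷ ts) noδ = record
    { above-α = λ j l → trans (FillA-β-strip Lα ts j l) (cα j l)
    ; above-γ = λ j l → trans (FillA-β-strip Lγ ts j l) (cγ j l)
    ; above-δ = λ j l → trans (+-congʳ (*-congˡ (FillA-β-strip Lδ ts j l))) (cδ j l)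
    ; above-β = λ j l → trans (+-congʳ (*-congˡ (FillA-β-strip Lβ ts j l))) (cβ j l)
    }
    where
    open ClosedForms (closed-forms ts noδ) renaming (above-α to cα; above-γ to cγ; above-δ to cδ; above-β to cβ)
  closed-forms (sδ ∷ ts) ()
  closed-forms (sαγ ∷ ts) noδ = record
    { above-α = closed-α-step ; above-γ = closed-γ-step ; above-δ = closed-δ-step ; above-β = closed-β-step }
    where
    k : ℕ
    k = #αγ ts
    open ClosedForms (closed-forms ts noδ) renaming (above-α to cα; above-γ to cγ; above-δ to cδ; above-β to cβ)
    Z-step : ∀ j l → Z t (suc k) j l ≈ β * Z t k j l + δ * q * Z t k (dec j) l + q * Z t k j (dec l)
    Z-step = Z-rec t k
    closed-α-step : ∀ j l → FillA Lα (sαγ ∷ ts) j l ≈ q * q * Z t (suc k) (dec j) l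
    closed-α-step j l = trans (FillA-α-step ts noδ j l) (trans (+-cong (+-cong (*-congˡ (cα j l)) (*-congˡ (cα (dec j) l))) (*-congˡ (cα j (dec l))))
      (trans (solve 6 (λ b d q z zx zy → b :* (q :* q :* z) :+ d :* q :* (q :* q :* zx) :+ q :* (q :* q :* zy) := q :* q :* (b :* z :+ d :* q :* zx :+ q :* zy)) refl β δ q (Z t k (dec j) l) (Z t k (dec (dec j)) l) (Z t k (dec j) (dec l)))
        (*-congˡ (sym (Z-step (dec j) l)))))
    closed-γ-step : ∀ j l → FillA Lγ (sαγ ∷ ts) j l ≈ Γ (suc k) * (q * q * Z t (suc k) (dec j) l)
    closed-γ-step j l = trans (FillA-γ-step ts noδ j l) (trans (*-congˡ (+-cong (+-cong (*-congˡ (cγ j l)) (*-congˡ (cγ (dec j) l))) (*-congˡ (cγ j (dec l)))))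
      (trans (solve 7 (λ b d q G z zx zy → q :* (b :* (G :* (q :* q :* z)) :+ d :* q :* (G :* (q :* q :* zx)) :+ q :* (G :* (q :* q :* zy))) := q :* G :* (q :* q :* (b :* z :+ d :* q :* zx :+ q :* zy))) refl β δ q (Γ k) (Z t k (dec j) l) (Z t k (dec (dec j)) l) (Z t k (dec j) (dec l)))
        (sym (*-cong (Γ-suc k) (*-congˡ (Z-step (dec j) l))))))
    -- the δ and β closed forms combine the four closed forms of the induction
    -- hypothesis, at (j,ℓ) and its shifts, with the recursion of Z
    closed-δ-step : ∀ j l → δ * FillA Lδ (sαγ ∷ ts) j l + α * Z t (suc (suc k)) j l ≈ U t (suc k) j l
    closed-δ-step j l = cancel
      (trans (+-congʳ (+-cong (*-congˡ (FillA-δ-step ts noδ j l)) (*-congˡ (Z-rec t (suc k) j l)))) (trans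
        (solve 26 (λ d b fδ q fδʲ fδˡ a fα fαʲ fαˡ fβ g fγ fγʲ fγˡ z₁ z₁ʲ z₁ˡ u uʲ uˡ zʲ zʲʲ zʲˡ vʲ G → (((d :* ((((b :* fδ) :+ ((d :* q) :* fδʲ)) :+ (q :* fδˡ)) :+ ((a :* (((b :* fα) :+ ((d :* q) :* fαʲ)) :+ (q :* fαˡ))) :+ ((b :* fβ) :+ ((g :* (((b :* fγ) :+ ((d :* q) :* fγʲ)) :+ (q :* fγˡ))) :+ (d :* ((q :* q) :* fδʲ))))))) :+ (a :* (((b :* z₁) :+ ((d :* q) :* z₁ʲ)) :+ (q :* z₁ˡ)))) :+ (((((((((((((b :* u) :+ ((d :* q) :* uʲ)) :+ (q :* uˡ)) :+ ((d :* (q :* q)) :* uʲ)) :+ (((d :* a) :* b) :* ((q :* q) :* zʲ))) :+ (((d :* a) :* (d :* q)) :* ((q :* q) :* zʲʲ))) :+ (((d :* a) :* q) :* ((q :* q) :* zʲˡ))) :+ (((d :* a) :* (q :* q)) :* z₁ʲ)) :+ (d :* ((q :* q) :* vʲ))) :+ (((d :* g) :* b) :* (G :* ((q :* q) :* zʲ)))) :+ (((d :* g) :* (d :* q)) :* (G :* ((q :* q) :* zʲʲ)))) :+ (((d :* g) :* q) :* (G :* ((q :* q) :* zʲˡ)))) :+ ((((d :* g) :* G) :* (q :* q)) :* z₁ʲ))) := (((d :* ((q :* q) :* (uʲ :+ vʲ))) :+ (((b :* u) :+ ((d :* q) :* uʲ)) :+ (q :* uˡ))) :+ (((((((((((((b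 :* ((d :* fδ) :+ (a :* z₁))) :+ ((d :* q) :* ((d :* fδʲ) :+ (a :* z₁ʲ)))) :+ (q :* ((d :* fδˡ) :+ (a :* z₁ˡ)))) :+ ((d :* (q :* q)) :* ((d :* fδʲ) :+ (a :* z₁ʲ)))) :+ (((d :* a) :* b) :* fα)) :+ (((d :* a) :* (d :* q)) :* fαʲ)) :+ (((d :* a) :* q) :* fαˡ)) :+ (((d :* a) :* (q :* q)) :* (((b :* zʲ) :+ ((d :* q) :* zʲʲ)) :+ (q :* zʲˡ)))) :+ (d :* ((b :* fβ) :+ ((g :* G) :* ((q :* q) :* z₁ʲ))))) :+ (((d :* g) :* b) :* fγ)) :+ (((d :* g) :* (d :* q)) :* fγʲ)) :+ (((d :* g) :* q) :* fγˡ)) :+ ((((d :* g) :* G) :* (q :* q)) :* (((b :* zʲ) :+ ((d :* q) :* zʲʲ)) :+ (q :* zʲˡ)))))) refl (δ) (β) (FillA Lδ ts j l) (q) (FillA Lδ ts (dec j) l) (FillA Lδ ts j (dec l)) (α) (FillA Lα ts j l) (FillA Lα ts (dec j) l) (FillA Lα ts j (dec l)) (FillA Lβ ts j l) (γ) (FillA Lγ ts j l) (FillA Lγ ts (dec j) l) (FillA Lγ ts j (dec l)) (Z t (suc k) j l) (Z t (suc k) (dec j) l) (Z t (suc k) j (dec l)) (U t k j l) (U t k (dec j) l) (U t k j (dec l)) (Z t k (dec j) l) (Z t k (dec (dec j)) l) (Z t k (dec j) (dec l)) (V t k (dec j) l) (Γ k))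
        (sym (+-congʳ (U-rec t k j l)))))
      (+-cong (+-cong (+-cong (+-cong (+-cong (+-cong (+-cong (+-cong (+-cong (+-cong (+-cong (+-cong (*-congˡ (sym (cδ j l))) (*-congˡ (sym (cδ (dec j) l)))) (*-congˡ (sym (cδ j (dec l))))) (*-congˡ (sym (cδ (dec j) l)))) (*-congˡ (sym (cα j l)))) (*-congˡ (sym (cα (dec j) l)))) (*-congˡ (sym (cα j (dec l))))) (*-congˡ (Z-step (dec j) l))) (*-congˡ (sym (cβ j l)))) (*-congˡ (sym (cγ j l)))) (*-congˡ (sym (cγ (dec j) l)))) (*-congˡ (sym (cγ j (dec l))))) (*-congˡ (Z-step (dec j) l)))
    closed-β-step : ∀ j l → β * FillA Lβ (sαγ ∷ ts) j l + γ * Γ (suc k) * (q * q * Z t (suc (suc k)) (dec j) l) ≈ q * q * V t (suc k) (dec j) l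
    closed-β-step j l = cancel
      (trans (+-congʳ (+-cong (*-congˡ (FillA-β-step ts noδ j l)) (*-cong (*-congˡ (Γ-suc k)) (*-congˡ (Z-rec t (suc k) (dec j) l))))) (trans
        (solve 26 (λ b q fβ d fβʲ fβˡ a fα fαʲ fαˡ g fγ fγʲ fγˡ fδʲ G z₁ʲ z₁ʲʲ z₁ʲˡ vʲ vʲʲ vʲˡ zʲ zʲʲ zʲˡ uʲ → (((b :* ((q :* (((b :* fβ) :+ ((d :* q) :* fβʲ)) :+ (q :* fβˡ))) :+ ((a :* (((b :* fα) :+ ((d :* q) :* fαʲ)) :+ (q :* fαˡ))) :+ ((b :* fβ) :+ ((g :* (((b :* fγ) :+ ((d :* q) :* fγʲ)) :+ (q :* fγˡ))) :+ (d :* ((q :* q) :* fδʲ))))))) :+ ((g :* (q :* G)) :* ((q :* q) :* (((b :* z₁ʲ) :+ ((d :* q) :* z₁ʲʲ)) :+ (q :* z₁ʲˡ))))) :+ ((((((((((((((q :* b) :* ((q :* q) :* vʲ)) :+ ((q :* (d :* q)) :* ((q :* q) :* vʲʲ))) :+ ((q :* q) :* ((q :* q) :* vʲˡ))) :+ (((b :* a) :* b) :* ((q :* q) :* zʲ))) :+ (((b :* a) :* (d :* q)) :* ((q :* q) :* zʲʲ))) :+ (((b :* a) :* q) :* ((q :* q) :* zʲˡ))) :+ (((b :* a) :* (q :* q)) :* z₁ʲ)) :+ (b :* ((q :* q) :* vʲ))) :+ (((b :* g) :* b) :* (G :* ((q :* q) :* zʲ)))) :+ (((b :* g) :* (d :*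 q)) :* (G :* ((q :* q) :* zʲʲ)))) :+ (((b :* g) :* q) :* (G :* ((q :* q) :* zʲˡ)))) :+ ((((b :* g) :* G) :* (q :* q)) :* z₁ʲ)) :+ ((b :* (q :* q)) :* uʲ))) := (((q :* q) :* ((b :* (uʲ :+ vʲ)) :+ (q :* (((b :* vʲ) :+ ((d :* q) :* vʲʲ)) :+ (q :* vʲˡ))))) :+ ((((((((((((((q :* b) :* ((b :* fβ) :+ ((g :* G) :* ((q :* q) :* z₁ʲ)))) :+ ((q :* (d :* q)) :* ((b :* fβʲ) :+ ((g :* G) :* ((q :* q) :* z₁ʲʲ))))) :+ ((q :* q) :* ((b :* fβˡ) :+ ((g :* G) :* ((q :* q) :* z₁ʲˡ))))) :+ (((b :* a) :* b) :* fα)) :+ (((b :* a) :* (d :* q)) :* fαʲ)) :+ (((b :* a) :* q) :* fαˡ)) :+ (((b :* a) :* (q :* q)) :* (((b :* zʲ) :+ ((d :* q) :* zʲʲ)) :+ (q :* zʲˡ)))) :+ (b :* ((b :* fβ) :+ ((g :* G) :* ((q :* q) :* z₁ʲ))))) :+ (((b :* g) :* b) :* fγ)) :+ (((b :* g) :* (d :* q)) :* fγʲ)) :+ (((b :* g) :* q) :* fγˡ)) :+ ((((b :* g) :* G) :* (q :* q)) :* (((b :* zʲ) :+ ((d :* q) :* zʲʲ)) :+ (q :* zʲˡ)))) :+ ((b :* (q :* q)) :* ((d :* fδʲ) :+ (a :* z₁ʲ)))))) refl (β) (q) (FillA Lβ ts j l) (δ) (FillA Lβ ts (dec j) l) (FillA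 Lβ ts j (dec l)) (α) (FillA Lα ts j l) (FillA Lα ts (dec j) l) (FillA Lα ts j (dec l)) (γ) (FillA Lγ ts j l) (FillA Lγ ts (dec j) l) (FillA Lγ ts j (dec l)) (FillA Lδ ts (dec j) l) (Γ k) (Z t (suc k) (dec j) l) (Z t (suc k) (dec (dec j)) l) (Z t (suc k) (dec j) (dec l)) (V t k (dec j) l) (V t k (dec (dec j)) l) (V t k (dec j) (dec l)) (Z t k (dec j) l) (Z t k (dec (dec j)) l) (Z t k (dec j) (dec l)) (U t k (dec j) l))
        (sym (+-congʳ (*-congˡ (V-rec t k (dec j) l))))))
      (+-cong (+-cong (+-cong (+-cong (+-cong (+-cong (+-cong (+-cong (+-cong (+-cong (+-cong (+-cong (*-congˡ (sym (cβ j l))) (*-congˡ (sym (cβ (dec j) l)))) (*-congˡ (sym (cβ j (dec l))))) (*-congˡ (sym (cα j l)))) (*-congˡ (sym (cα (dec j) l)))) (*-congˡ (sym (cα j (dec l))))) (*-congˡ (Z-step (dec j) l))) (*-congˡ (sym (cβ j l)))) (*-congˡ (sym (cγ j l)))) (*-congˡ (sym (cγ (dec j) l)))) (*-congˡ (sym (cγ j (dec l))))) (*-congˡ (Z-step (dec j) l))) (*-congˡ (sym (cδ (dec j) l))))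

  -- the second identity as a relation between arrays; the step to one more
  -- α/γ-strip uses both relations of the first identity, the β closed form
  -- and the recursion of Z
  MainRelation : List StripType → ℤ → ℤ → Set ℓ′
  MainRelation ts j l = V′ t (#αγ ts) j l + γ * δ * (q * q * Γ (#αγ ts)) * Z t (#αγ ts) (dec j) l + q * (δ * FirstβA ts j l)
                          ≈ q * V t (#αγ ts) j l + α * β * Z t (#αγ ts) j l + δ * FirstβA ts j l

  main-relation : ∀ ts → Noδ ts → ∀ j l → MainRelation ts j l
  main-relation [] noδ j l = trans (+-cong (+-cong (V′₀ t j l) refl) (*-congˡ (*-congˡ no-first-β)))
    (trans (solve 10 (λ g q p zˡ b a c z d zʲ → (((((g :* ((q :* q) :* p)) :* zˡ) :+ ((b :* ((a :+ (q :* c)) :+ ((g :* q) :* p))) :* z)) :+ (((g :* d) :* ((q :* q) :* p)) :* zʲ)) :+ (q :* (d :* con 0))) := (((q :* (((b :* c) :* z) :+ ((g :* p) :* (((b :* z) :+ ((d :* q) :* zʲ)) :+ (q :* zˡ))))) :+ ((a :* b) :* z)) :+ (d :* con 0))) refl (γ) (q) (pow q (t N.+ t N.+ 0)) (Z t 0 j (dec l)) (β) (α) (cst t) (Z t 0 j l) (δ) (Z t 0 (dec j) l))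
      (sym (+-cong (+-congʳ (*-congˡ (V₀ t j l))) (*-congˡ no-first-β))))
    where
    no-first-β : FirstβA [] j l ≈ 0#
    no-first-β = solve 4 (λ x00 x01 x10 x11 → (con 0 :+ ((con 0 :+ con 0 :* x00) :+ con 0 :* x01)) :+ ((con 0 :+ con 0 :* x10) :+ con 0 :* x11) := con 0) refl (A-slice 0 0 j l) (A-slice 0 1 j l) (A-slice 1 0 j l) (A-slice 1 1 j l)
  main-relation (sβ ∷ ts) noδ j l = trans (+-congˡ (*-congˡ (*-congˡ (FirstβA-β-strip ts j l)))) (trans (main-relation ts noδ j l) (+-congˡ (*-congˡ (sym (FirstβA-β-strip ts j l)))))
  main-relation (sδ ∷ ts) ()
  main-relation (sαγ ∷ ts) noδ j l = cancel
      (trans (+-congʳ (+-cong (+-cong (V′-rec t k j l) (*-congʳ (*-congˡ (*-congˡ (Γ-suc k))))) (*-congˡ (*-congˡ (FirstβA-step ts noδ j l))))) (trans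
        (solve 25 (λ b v′ d q v′ʲ u′ v′ˡ g G z₁ʲ r rʲ rˡ fβ v a z vʲ zʲ vˡ zˡ u z₁ zʲʲ zʲˡ → ((((((b :* v′) :+ ((d :* q) :* (q :* v′ʲ))) :+ (q :* ((b :* (u′ :+ v′)) :+ (q :* v′ˡ)))) :+ (((g :* d) :* ((q :* q) :* (q :* G))) :* z₁ʲ)) :+ (q :* (d :* ((((b :* r) :+ ((d :* q) :* rʲ)) :+ (q :* rˡ)) :+ (b :* fβ))))) :+ ((((((((((b :* (((q :* v) :+ ((a :* b) :* z)) :+ (d :* r))) :+ ((d :* q) :* (((q :* vʲ) :+ ((a :* b) :* zʲ)) :+ (d :* rʲ)))) :+ (q :* (((q :* vˡ) :+ ((a :* b) :* zˡ)) :+ (d :* rˡ)))) :+ ((b :* q) :* (u :+ (q :* v)))) :+ (q :* ((d :* v′ʲ) :+ v′ˡ))) :+ ((q :* q) :* ((q :* vˡ) :+ (b :* u′)))) :+ (d :* ((b :* fβ) :+ ((g :* G) :* ((q :* q) :* z₁ʲ))))) :+ ((q :* d) :* ((q :* q) :* vʲ))) :+ ((a :* b) :* z₁)) :+ ((((d :* (q :* q)) :* g) :* G) :* (((b :* zʲ) :+ ((d :* q) :* zʲʲ)) :+ (q :* zʲˡ))))) := ((((q :* ((b :* (u :+ v)) :+ (q :* (((b :* v) :+ ((d :* q) :* vʲ)) :+ (q :* vˡ))))) :+ ((a :* b) :* z₁)) :+ (d :* ((((b :* r) :+ ((d :* q) :* rʲ)) :+ (q :* rˡ)) :+ (b :*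 fβ)))) :+ ((((((((((b :* ((v′ :+ (((g :* d) :* ((q :* q) :* G)) :* zʲ)) :+ (q :* (d :* r)))) :+ ((d :* q) :* ((v′ʲ :+ (((g :* d) :* ((q :* q) :* G)) :* zʲʲ)) :+ (q :* (d :* rʲ))))) :+ (q :* ((v′ˡ :+ (((g :* d) :* ((q :* q) :* G)) :* zʲˡ)) :+ (q :* (d :* rˡ))))) :+ ((b :* q) :* ((q :* u′) :+ v′))) :+ (q :* ((q :* vˡ) :+ (b :* u′)))) :+ ((q :* q) :* ((d :* v′ʲ) :+ v′ˡ))) :+ (d :* ((q :* q) :* vʲ))) :+ ((q :* d) :* ((b :* fβ) :+ ((g :* G) :* ((q :* q) :* z₁ʲ))))) :+ ((a :* b) :* (((b :* z) :+ ((d :* q) :* zʲ)) :+ (q :* zˡ)))) :+ ((((d :* (q :* q)) :* g) :* G) :* z₁ʲ)))) refl (β) (V′ t k j l) (δ) (q) (V′ t k (dec j) l) (U′ t k j l) (V′ t k j (dec l)) (γ) (Γ k) (Z t (suc k) (dec j) l) (FirstβA ts j l) (FirstβA ts (dec j) l) (FirstβA ts j (dec l)) (FillA Lβ ts j l) (V t k j l) (α) (Z t k j l) (V t k (dec j) l) (Z t k (dec j) l) (V t k j (dec l)) (Z t k j (dec l)) (U t k j l) (Z t (suc k) j l) (Z t k (dec (dec j)) l) (Z t k (dec j) (dec l)))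
        (sym (+-congʳ (+-cong (+-congʳ (*-congˡ (V-rec t k j l))) (*-congˡ (FirstβA-step ts noδ j l)))))))
      (+-cong (+-cong (+-cong (+-cong (+-cong (+-cong (+-cong (+-cong (+-cong (*-congˡ (sym (ih j l))) (*-congˡ (sym (ih (dec j) l)))) (*-congˡ (sym (ih j (dec l))))) (*-congˡ (rel₁ j l))) (*-congˡ (rel₂ j l))) (*-congˡ (sym (rel₂ j l)))) (*-congˡ (closed-β j l))) (*-congˡ (sym (closed-β j l)))) (*-congˡ (Z-step j l))) (*-congˡ (sym (Z-step (dec j) l))))
    where
    k : ℕ
    k = #αγ ts
    ih : ∀ j l → MainRelation ts j l
    ih = main-relation ts noδ
    rel₁ : ∀ j l → Rel₁ t k j l
    rel₁ = proj₁ (relations t k)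
    rel₂ : ∀ j l → Rel₂ t k j l
    rel₂ = proj₂ (relations t k)
    closed-β : ∀ j l → β * FillA Lβ ts j l + γ * Γ k * (q * q * Z t (suc k) (dec j) l) ≈ q * q * V t k (dec j) l
    closed-β = ClosedForms.above-β (closed-forms ts noδ)
    Z-step : ∀ j l → Z t (suc k) j l ≈ β * Z t k j l + δ * q * Z t k (dec j) l + q * Z t k j (dec l)
    Z-step = Z-rec t k

  pow-2t+k+2 : ∀ k → q * q * pow q (t N.+ t N.+ k) ≈ pow q (t N.+ t N.+ k N.+ 2)
  pow-2t+k+2 k rewrite NP.+-comm (t N.+ t N.+ k) 2 = *-assoc q q _

  Aprev≡Z : ∀ j k l → Aprev j k l ≡ Z t k (dec (+ j)) (+ l)
  Aprev≡Z zero k l = P.refl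
  Aprev≡Z (suc j) k l = P.refl

  FA≈FirstβA : ∀ ts → Noδ ts → ∀ j l → prod0 (λ _ a _ b → F t ts a b) A j (#αγ ts) l ≈ δ * FirstβA ts (+ j) (+ l)
  FA≈FirstβA ts noδ j l = trans (prod0≈Φ (λ _ a _ b → F t ts a b) A j (#αγ ts) l)
    (trans (Φ-congS (suc (suc (j N.+ #αγ ts))) (suc (suc (#αγ ts))) {RA = A-slice} (λ a b → F≈Firstβ t ts a b) (+ j) (+ l))
    (trans (Φ-*S (suc (suc (j N.+ #αγ ts))) (suc (suc (#αγ ts))) δ (Firstβ t ts) A-slice (+ j) (+ l))
      (*-congˡ (Φ-ext A-slice (proj₂ (Fill-supported ts noδ)) (N.s≤s (N.s≤s (NP.m≤n+m (#αγ ts) j))) NP.≤-refl (+ j) (+ l)))))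

  second-identity : ∀ j l ts → Noδ ts → ∀ k → countType sαγ ts ≡ k →
    prod0 A (E (suc t)) j k l - q * prod0 (E t) A j k l
      ≈ α * β * A 0 j k l - γ * δ * pow q (t N.+ t N.+ k N.+ 2) * Aprev j k l + (1# - q) * prod0 (λ _ a _ b → F t ts a b) A j k l
  second-identity j l ts noδ .(countType sαγ ts) P.refl = begin
    prod0 A (E (suc t)) j k l - q * prod0 (E t) A j k l
      ≈⟨ +-cong (AE≈V′ t j k l) (-‿cong (*-congˡ (EA≈V t j k l))) ⟩
    V′ t k (+ j) (+ l) - q * V t k (+ j) (+ l)
      ≈⟨ swap-sides-scaled q {a = α * β} (main-relation ts noδ (+ j) (+ l)) ⟩
    α * β * Z t k (+ j) (+ l) - γ * δ * (q * q * Γ k) * Z t k (dec (+ j)) (+ l) + (1# - q) * (δ * FirstβA ts (+ j) (+ l))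
      ≈⟨ +-cong (+-congˡ (-‿cong (*-cong (*-congˡ (pow-2t+k+2 k)) (reflexive (P.sym (Aprev≡Z j k l)))))) (*-congˡ (sym (FA≈FirstβA ts noδ j l))) ⟩
    α * β * A 0 j k l - γ * δ * pow q (t N.+ t N.+ k N.+ 2) * Aprev j k l + (1# - q) * prod0 (λ _ a _ b → F t ts a b) A j k l ∎
    where
    k : ℕ
    k = countType sαγ ts

lemma7p15 : ∀ {c ℓ′} (R : CommutativeRing c ℓ′) (α β γ δ q : CommutativeRing.Carrier R) →
    let open CommutativeRing R
        open Matrices R α β γ δ q
    in ∀ (t j k ℓ : ℕ) →
       (prod0 (D t) A j k ℓ - q * prod0 A (D (suc t)) j k ℓ
          ≈ prod0 A (E (suc t)) j k ℓ - q * prod0 (E t) A j k ℓ)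
       × (∀ (ts : List StripType) → countType sδ ts ≡ 0 → countType sαγ ts ≡ k →
            prod0 A (E (suc t)) j k ℓ - q * prod0 (E t) A j k ℓ
              ≈ α * β * A 0 j k ℓ - γ * δ * pow q (t N.+ t N.+ k N.+ 2) * Aprev j k ℓ
                + (1# - q) * prod0 (λ _ a _ b → F t ts a b) A j k ℓ)
lemma7p15 R α β γ δ q t j k ℓ =
  FirstIdentity.first-identity R α β γ δ q t j k ℓ ,
  λ ts noδ αγ-count → SecondIdentity.second-identity R α β γ δ q t j ℓ ts noδ k αγ-count
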